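{- Let $n\ge 3$, let $p\ne q$ be elements of $[n]=\{1,\ldots,n\}$, and let $X$ be a nonempty subset of $[n]\setminus\{p,q\}$. Let $\mathcal{E}_X$ be the associative algebra generated by the symbols $i$ and $i'$ for $i\in X$, together with symbols $p'$, $q$, $*$, subject to the relations: (1) $p'=-q=*$; (2) $i^2=i'^2=*^2=0$ for $i\in X$; (3) $ii'=*i-i'*$ and $i'i=i*-*i'$ for $i\in X$; (4) $ij'=j'i$ for all $i\ne j$ in $X$. For $A=\{i_1,\ldots,i_s\}\subseteq X\cup\{q\}$ listed so that $C(i_1,\ldots,i_s,p)$ holds, put $\pi(A):=i_1i_2\cdots i_s\in\mathcal{E}_X$; for $B=\{j_1,\ldots,j_t\}\subseteq X\cup\{p\}$ listed so that $C(j_1,\ldots,j_t,q)$ holds, put $\pi'(B):=j_1'j_2'\cdots j_t'\in\mathcal{E}_X$. Then for every integer $d$ with $|X|\le d\le 2|X|+2$, \[\sum_{(A,B)}\big(\pi(A)\pi'(B)-\pi'(B)\pi(A)\big)=0\quad\text{in }\mathcal{E}_X,\] where the sum ranges over all pairs of sets $(A,B)$ with $X\subseteq A\cup B\subseteq X\cup\{p,q\}$, $|A|+|B|=d$, $A\ne\emptyset\ne B$, $p\notin A$ and $q\notin B$.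
   Context: For $c\in[n]$ and distinct elements $a_1,\ldots,a_k\in[n]\setminus\{c\}$, the predicate $C(a_1,\ldots,a_k,c)$ means that $a_1,\ldots,a_k$ appear in the order in which they are encountered when traversing $c-1,c-2,\ldots,1,n,n-1,\ldots,c+1$; equivalently, writing the elements less than $c$ as $a_1,\ldots,a_r$ and the remaining ones as $a_{r+1},\ldots,a_k$, one has $a_r<\cdots<a_1<c<a_k<\cdots<a_{r+1}$. In $\pi(A)$ the letter $q$ (if $q\in A$) is the generator $q$ of $\mathcal{E}_X$, and in $\pi'(B)$ the letter $p'$ (if $p\in B$) is the generator $p'$. (Intuitively, the letter $i$ stands for $[ip]$ and $i'$ for $[iq]$ in the Fomin–Kirillov quadratic algebra.) -}

module Defs where

open import Level using (Level)
open import Data.Nat as ℕ using (ℕ; zero; suc)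
open import Data.Fin as Fin using (Fin)
open import Data.Fin.Properties using (_<?_)
open import Data.Fin.Subset using (Subset; _∈_; _∉_; _⊆_; _∪_; ⁅_⁆; ∣_∣; Nonempty; inside; outside)
open import Data.Fin.Subset.Properties using (_∈?_; _⊆?_; nonempty?)
open import Data.List using (List; []; _∷_; _++_; map; filter; reverse; allFin; foldr; cartesianProduct)
open import Data.Vec using (_∷_)
open import Data.Product using (_×_; _,_)
open import Relation.Binary.PropositionalEquality using (_≡_)
open import Relation.Nullary using (¬_)
open import Relation.Nullary.Decidable using (Dec; _×-dec_; ¬?)
open import Algebra.Bundles using (Ring)

allSubsets : ∀ n → List (Subset n)
allSubsets zero = Data.List.[ Data.Vec.[] ]
allSubsets (suc n) = map (outside ∷_) (allSubsets n) ++ map (inside ∷_) (allSubsets n)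

-- The elements of [n] \ {c} in the order c-1, c-2, ..., 1, n, n-1, ..., c+1
-- (here [n] is modelled by Fin n = {0,...,n-1}, order preserved).
-- A list of distinct elements a₁,…,a_k satisfies C(a₁,…,a_k,c) iff it is a
-- sublist of this list.
cycOrder : ∀ {n} → Fin n → List (Fin n)
cycOrder {n} c =
  filter (λ i → i <? c) (reverse (allFin n)) ++ filter (λ i → c <? i) (reverse (allFin n))

cycList : ∀ {n} → Fin n → Subset n → List (Fin n)
cycList c A = filter (λ i → i ∈? A) (cycOrder c)

Cond : ∀ {n} → (X : Subset n) (p q : Fin n) (d : ℕ) → Subset n × Subset n → Set
Cond X p q d (A , B) =
  (X ⊆ (A ∪ B)) × ((A ∪ B) ⊆ (X ∪ (⁅ p ⁆ ∪ ⁅ q ⁆))) × (∣ A ∣ ℕ.+ ∣ B ∣ ≡ d)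
  × Nonempty A × Nonempty B × (p ∉ A) × (q ∉ B)

cond? : ∀ {n} → (X : Subset n) (p q : Fin n) (d : ℕ) → (AB : Subset n × Subset n) → Dec (Cond X p q d AB)
cond? X p q d (A , B) =
  (X ⊆? (A ∪ B)) ×-dec ((A ∪ B) ⊆? (X ∪ (⁅ p ⁆ ∪ ⁅ q ⁆))) ×-dec (∣ A ∣ ℕ.+ ∣ B ∣ ℕ.≟ d)
  ×-dec nonempty? A ×-dec nonempty? B ×-dec ¬? (p ∈? A) ×-dec ¬? (q ∈? B)

indexPairs : ∀ {n} → (X : Subset n) (p q : Fin n) (d : ℕ) → List (Subset n × Subset n)
indexPairs {n} X p q d = filter (cond? X p q d) (cartesianProduct (allSubsets n) (allSubsets n))

module _ {c ℓ : Level} (R : Ring c ℓ) where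
  open Ring R

  prodR : List Carrier → Carrier
  prodR = foldr _*_ 1#

  sumR : List Carrier → Carrier
  sumR = foldr _+_ 0#

  -- The defining relations of 𝓔_X for an interpretation of the generators:
  -- unp i  interprets the letter i,  pr i  interprets i',  star interprets *.
  -- (Only unp i, pr i for i ∈ X, unp q, pr p matter.)
  record Relations {n} (X : Subset n) (p q : Fin n)
                   (unp pr : Fin n → Carrier) (star : Carrier) : Set (c Level.⊔ ℓ) where
    field
      rel-p' : pr p ≈ star
      rel-q  : - unp q ≈ star
      rel-sq  : ∀ i → i ∈ X → unp i * unp i ≈ 0#
      rel-sq' : ∀ i → i ∈ X → pr i * pr i ≈ 0#
      rel-star : star * star ≈ 0#
      rel-ii' : ∀ i → i ∈ X → unp i * pr i ≈ star * unp i - pr i * star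
      rel-i'i : ∀ i → i ∈ X → pr i * unp i ≈ unp i * star - star * pr i
      rel-ij' : ∀ i j → i ∈ X → j ∈ X → ¬ (i ≡ j) → unp i * pr j ≈ pr j * unp i

  πA : ∀ {n} → (unp : Fin n → Carrier) (p : Fin n) → Subset n → Carrier
  πA unp p A = prodR (map unp (cycList p A))

  π'B : ∀ {n} → (pr : Fin n → Carrier) (q : Fin n) → Subset n → Carrier
  π'B pr q B = prodR (map pr (cycList q B))

  commSum : ∀ {n} → (X : Subset n) (p q : Fin n) (d : ℕ) (unp pr : Fin n → Carrier) → Carrier
  commSum X p q d unp pr =
    sumR (map (λ { (A , B) → πA unp p A * π'B pr q B - π'B pr q B * πA unp p A })
              (indexPairs X p q d))

{-# OPTIONS --safe #-}
module Submission where

-- Record a pair (A , B) by its entries (j ∈ A , j ∈ B): the pairs summed over are then the vectors of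
-- entries taken from fixed per-coordinate option lists, with total degree |A| + |B| = d. Split the
-- cyclic orders as cycOrder p = L₁ ++ q ∷ L₂ and cycOrder q = L₂ ++ p ∷ L₁, and write [x] for the
-- letter x if it occurs and 1 otherwise. By (4), π(A) π′(B) = ∏_{L₁} [j] · [q] · ∏_{L₂} [j][j′] · [p′] · ∏_{L₁} [j′].
-- For j ∈ L₂, relations (1)–(3) show that summing [q] · [j][j′] and [j′][j] · [q] over the entries at q
-- and j gives the same result in each degree; as the rest of the summand ignores these two coordinates,
-- [q] slides through the product over L₂. In the same way [q][p′] may be replaced by 1 when both letters
-- are absent and by 0 otherwise. Treating π′(B) π(A) symmetrically, both sums reach the same expression by (4).

open import Level using (Level)
open import Data.Bool using (Bool; true; false; if_then_else_)
open import Data.Nat using (ℕ; zero; suc)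
open import Data.Fin using (Fin; zero; suc)
open import Data.Fin.Subset using (Subset; ∣_∣; _∪_; ⁅_⁆; _⊆_; Nonempty) renaming (_∈_ to _∈ₛ_; _∉_ to _∉ₛ_)
open import Data.Vec using ([]; _∷_; lookup; _[_]≔_)
open import Data.Vec.Properties using (lookup∘update; lookup∘update′; []≔-commutes)
open import Data.List using (List; []; _∷_; _++_; map; filter; cartesianProduct)
open import Data.List.Properties using (map-∘)
open import Data.List.Membership.Propositional.Properties
  using (∈-filter⁺; ∈-filter⁻; ∈-cartesianProduct⁻; ∈-++⁺ˡ; ∈-++⁺ʳ)
open import Data.List.Relation.Unary.All.Properties using (All¬⇒¬Any)
open import Data.List.Relation.Unary.Unique.Propositional using (Unique)
open import Data.List.Relation.Unary.Any using (here; there)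
open import Data.List.Relation.Unary.All as All using (All; []; _∷_)
open import Data.List.Relation.Unary.AllPairs as AllPairs using (AllPairs; []; _∷_)
open import Data.Product using (_×_; _,_; proj₁; proj₂; ∃; uncurry)
open import Data.Sum using (_⊎_; inj₁; inj₂)
open import Relation.Binary.PropositionalEquality as ≡ using (_≡_; _≢_)
open import Relation.Nullary using (¬_; Dec; does; yes; no)
open import Relation.Unary using (Pred; Decidable)
open import Function using (_∘_; case_of_)
open import Data.Empty using (⊥-elim)
open import Algebra.Bundles using (Ring)
open import Defs
import Data.Nat.Properties

module FiniteSums {c ℓ : Level} (R : Ring c ℓ) where
  open import Data.List.Membership.Propositional using (_∈_; _∉_)
  open Ring R
  open import Algebra.Properties.Ring R using (-‿+-comm; -0#≈0#)
  open import Algebra.Properties.CommutativeSemigroup +-commutativeSemigroup using (interchange)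
  open import Relation.Binary.Reasoning.Setoid setoid

  private variable
    a b : Level
    A B : Set a

  ∑ : List A → (A → Carrier) → Carrier
  ∑ xs f = sumR R (map f xs)

  ∏ : List A → (A → Carrier) → Carrier
  ∏ xs f = prodR R (map f xs)

  ∑-cong-∈ : ∀ xs {f g : A → Carrier} → (∀ {x} → x ∈ xs → f x ≈ g x) → ∑ xs f ≈ ∑ xs g
  ∑-cong-∈ []       f≈g = refl
  ∑-cong-∈ (x ∷ xs) f≈g = +-cong (f≈g (here ≡.refl)) (∑-cong-∈ xs (f≈g ∘ there))

  ∑-cong : ∀ xs {f g : A → Carrier} → (∀ x → f x ≈ g x) → ∑ xs f ≈ ∑ xs g
  ∑-cong xs f≈g = ∑-cong-∈ xs (λ {x} _ → f≈g x)

  ∑-zero : ∀ xs {f : A → Carrier} → (∀ x → f x ≈ 0#) → ∑ xs f ≈ 0#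
  ∑-zero []       f≈0 = refl
  ∑-zero (x ∷ xs) f≈0 = trans (+-cong (f≈0 x) (∑-zero xs f≈0)) (+-identityˡ 0#)

  ∑-++ : ∀ xs ys (f : A → Carrier) → ∑ (xs ++ ys) f ≈ ∑ xs f + ∑ ys f
  ∑-++ []       ys f = sym (+-identityˡ _)
  ∑-++ (x ∷ xs) ys f = trans (+-congˡ (∑-++ xs ys f)) (sym (+-assoc _ _ _))

  ∑-+ : ∀ xs (f g : A → Carrier) → ∑ xs (λ x → f x + g x) ≈ ∑ xs f + ∑ xs g
  ∑-+ []       f g = sym (+-identityˡ 0#)
  ∑-+ (x ∷ xs) f g = trans (+-congˡ (∑-+ xs f g)) (interchange _ _ _ _)

  ∑-neg : ∀ xs (f : A → Carrier) → ∑ xs (λ x → - f x) ≈ - ∑ xs f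
  ∑-neg []       f = sym -0#≈0#
  ∑-neg (x ∷ xs) f = trans (+-congˡ (∑-neg xs f)) (-‿+-comm _ _)

  ∑-distribˡ : ∀ xs a (f : A → Carrier) → a * ∑ xs f ≈ ∑ xs (λ x → a * f x)
  ∑-distribˡ []       a f = zeroʳ a
  ∑-distribˡ (x ∷ xs) a f = trans (distribˡ _ _ _) (+-congˡ (∑-distribˡ xs a f))

  ∑-distribʳ : ∀ xs a (f : A → Carrier) → ∑ xs f * a ≈ ∑ xs (λ x → f x * a)
  ∑-distribʳ []       a f = zeroˡ a
  ∑-distribʳ (x ∷ xs) a f = trans (distribʳ _ _ _) (+-congˡ (∑-distribʳ xs a f))

  ∑-map : ∀ (h : B → A) xs (f : A → Carrier) → ∑ (map h xs) f ≡ ∑ xs (f ∘ h)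
  ∑-map h xs f = ≡.cong (sumR R) (≡.sym (map-∘ xs))

  ∑-comm : ∀ xs ys (f : A → B → Carrier) → ∑ xs (λ x → ∑ ys (f x)) ≈ ∑ ys (λ y → ∑ xs (λ x → f x y))
  ∑-comm []       ys f = sym (∑-zero ys (λ _ → refl))
  ∑-comm (x ∷ xs) ys f = trans (+-congˡ (∑-comm xs ys f)) (sym (∑-+ ys (f x) _))

  ∑-cartesianProduct : ∀ xs ys (f : A × B → Carrier) →
                       ∑ (cartesianProduct xs ys) f ≈ ∑ xs (λ x → ∑ ys (λ y → f (x , y)))
  ∑-cartesianProduct []       ys f = refl
  ∑-cartesianProduct (x ∷ xs) ys f = begin
    ∑ (map (x ,_) ys ++ cartesianProduct xs ys) f
      ≈⟨ ∑-++ (map (x ,_) ys) _ f ⟩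
    ∑ (map (x ,_) ys) f + ∑ (cartesianProduct xs ys) f
      ≈⟨ +-cong (reflexive (∑-map (x ,_) ys f)) (∑-cartesianProduct xs ys f) ⟩
    ∑ ys (λ y → f (x , y)) + ∑ xs (λ x → ∑ ys (λ y → f (x , y))) ∎

  module _ {p} {P : Pred A p} (P? : Decidable P) where

    ∑-filter : ∀ xs (f : A → Carrier) → ∑ (filter P? xs) f ≈ ∑ xs (λ x → if does (P? x) then f x else 0#)
    ∑-filter []       f = refl
    ∑-filter (x ∷ xs) f with does (P? x)
    ... | true  = +-congˡ (∑-filter xs f)
    ... | false = trans (∑-filter xs f) (sym (+-identityˡ _))

    ∏-filter : ∀ xs (f : A → Carrier) → ∏ (filter P? xs) f ≈ ∏ xs (λ x → if does (P? x) then f x else 1#)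
    ∏-filter []       f = refl
    ∏-filter (x ∷ xs) f with does (P? x)
    ... | true  = *-congˡ (∏-filter xs f)
    ... | false = trans (∏-filter xs f) (sym (*-identityˡ _))

    ∑-filter-supported : ∀ xs (f : A → Carrier) → (∀ x → x ∉ filter P? xs → f x ≈ 0#) →
                         ∑ xs f ≈ ∑ (filter P? xs) f
    ∑-filter-supported xs f supp = sym (trans (∑-filter xs f) (∑-cong-∈ xs vanish))
      where
      vanish : ∀ {x} → x ∈ xs → (if does (P? x) then f x else 0#) ≈ f x
      vanish {x} x∈xs with P? x
      ... | yes _  = refl
      ... | no ¬Px = sym (supp x (λ x∈filter → ¬Px (proj₂ (∈-filter⁻ P? {xs = xs} x∈filter))))

  ∏-++ : ∀ xs ys (f : A → Carrier) → ∏ (xs ++ ys) f ≈ ∏ xs f * ∏ ys f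
  ∏-++ []       ys f = sym (*-identityˡ _)
  ∏-++ (x ∷ xs) ys f = trans (*-congˡ (∏-++ xs ys f)) (sym (*-assoc _ _ _))

  ∏-commute : ∀ xs (f : A → Carrier) {a} → (∀ {x} → x ∈ xs → a * f x ≈ f x * a) → a * ∏ xs f ≈ ∏ xs f * a
  ∏-commute []       f {a} comm = trans (*-identityʳ a) (sym (*-identityˡ a))
  ∏-commute (x ∷ xs) f {a} comm = begin
    a * (f x * ∏ xs f)   ≈⟨ sym (*-assoc _ _ _) ⟩
    (a * f x) * ∏ xs f   ≈⟨ *-congʳ (comm (here ≡.refl)) ⟩
    (f x * a) * ∏ xs f   ≈⟨ *-assoc _ _ _ ⟩
    f x * (a * ∏ xs f)   ≈⟨ *-congˡ (∏-commute xs f (comm ∘ there)) ⟩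
    f x * (∏ xs f * a)   ≈⟨ sym (*-assoc _ _ _) ⟩
    (f x * ∏ xs f) * a   ∎

  ∏-interleave : ∀ xs (f g : A → Carrier) → AllPairs (λ x y → g x * f y ≈ f y * g x) xs →
                 ∏ xs f * ∏ xs g ≈ ∏ xs (λ x → f x * g x)
  ∏-interleave []       f g []             = *-identityˡ 1#
  ∏-interleave (x ∷ xs) f g (comm ∷ comms) = begin
    (f x * ∏ xs f) * (g x * ∏ xs g)   ≈⟨ *-assoc _ _ _ ⟩
    f x * (∏ xs f * (g x * ∏ xs g))   ≈⟨ *-congˡ (sym (*-assoc _ _ _)) ⟩
    f x * ((∏ xs f * g x) * ∏ xs g)   ≈⟨ *-congˡ (*-congʳ (sym (∏-commute xs f (All.lookup comm)))) ⟩
    f x * ((g x * ∏ xs f) * ∏ xs g)   ≈⟨ *-congˡ (*-assoc _ _ _) ⟩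
    f x * (g x * (∏ xs f * ∏ xs g))   ≈⟨ sym (*-assoc _ _ _) ⟩
    (f x * g x) * (∏ xs f * ∏ xs g)   ≈⟨ *-congˡ (∏-interleave xs f g comms) ⟩
    (f x * g x) * ∏ xs (λ x → f x * g x) ∎

  ∏-cong-∈ : ∀ xs {f g : A → Carrier} → (∀ {x} → x ∈ xs → f x ≈ g x) → ∏ xs f ≈ ∏ xs g
  ∏-cong-∈ []       f≈g = refl
  ∏-cong-∈ (x ∷ xs) f≈g = *-cong (f≈g (here ≡.refl)) (∏-cong-∈ xs (f≈g ∘ there))

module DistinctLists where
  open import Data.List.Membership.Propositional using (_∈_; _∉_)

  private variable
    a r : Level
    A : Set a

  Unique-++⁻ : ∀ (xs : List A) {ys} → Unique (xs ++ ys) → Unique xs × Unique ys × (∀ {x} → x ∈ xs → x ∉ ys)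
  Unique-++⁻ []       unique          = [] , unique , λ ()
  Unique-++⁻ (x ∷ xs) (x∉ ∷ unique) with uxs , uys , disjoint ← Unique-++⁻ xs unique =
      All.tabulate (λ y∈xs → All.lookup x∉ (∈-++⁺ˡ y∈xs)) ∷ uxs
    , uys
    , λ { (here ≡.refl) y∈ys → All.lookup x∉ (∈-++⁺ʳ xs y∈ys) ≡.refl ; (there y∈xs) → disjoint y∈xs }

  ∈-∉⇒≢ : ∀ {x y : A} {xs} → x ∈ xs → y ∉ xs → x ≢ y
  ∈-∉⇒≢ x∈ y∉ ≡.refl = y∉ x∈

  Unique⇒AllPairs : ∀ {R : A → A → Set r} {xs} → Unique xs →
                    (∀ {x y} → x ∈ xs → y ∈ xs → x ≢ y → R x y) → AllPairs R xs
  Unique⇒AllPairs []             R-distinct = []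
  Unique⇒AllPairs (x∉ ∷ unique) R-distinct =
    All.tabulate (λ y∈ → R-distinct (here ≡.refl) (there y∈) (All.lookup x∉ y∈))
    ∷ Unique⇒AllPairs unique (λ x∈ y∈ → R-distinct (there x∈) (there y∈))

module States where
  open import Data.List.Membership.Propositional using (_∈_; _∉_)
  open Data.Nat using (_+_; _≡ᵇ_)

  Entry : Set
  Entry = Bool × Bool

  State : ℕ → Set
  State n = Subset n × Subset n

  infixr 5 _∷ₛ_
  _∷ₛ_ : ∀ {n} → Entry → State n → State (suc n)
  (a , b) ∷ₛ (A , B) = (a ∷ A , b ∷ B)

  entry : ∀ {n} → State n → Fin n → Entry
  entry (A , B) j = (lookup A j , lookup B j)

  update : ∀ {n} → State n → Fin n → Entry → State n
  update (A , B) j (a , b) = (A [ j ]≔ a , B [ j ]≔ b)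

  entry-update-≡ : ∀ {n} (s : State n) j x → entry (update s j x) j ≡ x
  entry-update-≡ (A , B) j (a , b) = ≡.cong₂ _,_ (lookup∘update j A a) (lookup∘update j B b)

  entry-update-≢ : ∀ {n} (s : State n) {i j} → i ≢ j → ∀ x → entry (update s j x) i ≡ entry s i
  entry-update-≢ (A , B) i≢j (a , b) = ≡.cong₂ _,_ (lookup∘update′ i≢j A a) (lookup∘update′ i≢j B b)

  update-comm : ∀ {n} (s : State n) {i j} → i ≢ j → ∀ x y → update (update s i x) j y ≡ update (update s j y) i x
  update-comm (A , B) {i} {j} i≢j (a , b) (c , d) =
    ≡.cong₂ _,_ ([]≔-commutes A i j i≢j) ([]≔-commutes B i j i≢j)

  allEntries : List Entry
  allEntries = cartesianProduct (false ∷ true ∷ []) (false ∷ true ∷ [])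

  ∈-allEntries : ∀ x → x ∈ allEntries
  ∈-allEntries (false , false) = here ≡.refl
  ∈-allEntries (false , true)  = there (here ≡.refl)
  ∈-allEntries (true  , false) = there (there (here ≡.refl))
  ∈-allEntries (true  , true)  = there (there (there (here ≡.refl)))

  Options : ℕ → Set
  Options n = Fin n → List Entry

  Admissible : ∀ {n} → Options n → State n → Set
  Admissible O s = ∀ j → entry s j ∈ O j

  admissible-∷ : ∀ {n} {O : Options (suc n)} {x s} → x ∈ O zero → Admissible (O ∘ suc) s → Admissible O (x ∷ₛ s)
  admissible-∷ x∈ adm zero    = x∈
  admissible-∷ x∈ adm (suc j) = adm j

  blank : Entry
  blank = (false , false)

  count : Bool → ℕ
  count true  = 1
  count false = 0

  size : Entry → ℕ
  size (a , b) = count a + count b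

  degree : ∀ {n} → State n → ℕ
  degree (A , B) = ∣ A ∣ + ∣ B ∣

  ∣[]≔∣ : ∀ {n} (A : Subset n) j a → ∣ A [ j ]≔ a ∣ ≡ ∣ A [ j ]≔ false ∣ + count a
  ∣[]≔∣ (_ ∷ A) zero    true  = Data.Nat.Properties.+-comm 1 _
  ∣[]≔∣ (_ ∷ A) zero    false = ≡.sym (Data.Nat.Properties.+-identityʳ _)
  ∣[]≔∣ (true  ∷ A) (suc j) a = ≡.cong suc (∣[]≔∣ A j a)
  ∣[]≔∣ (false ∷ A) (suc j) a = ∣[]≔∣ A j a

  degree-update : ∀ {n} (s : State n) j x → degree (update s j x) ≡ degree (update s j blank) + size x
  degree-update (A , B) j (a , b) = begin
    ∣ A [ j ]≔ a ∣ + ∣ B [ j ]≔ b ∣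
      ≡⟨ ≡.cong₂ _+_ (∣[]≔∣ A j a) (∣[]≔∣ B j b) ⟩
    (∣ A [ j ]≔ false ∣ + count a) + (∣ B [ j ]≔ false ∣ + count b)
      ≡⟨ interchange (∣ A [ j ]≔ false ∣) (count a) _ (count b) ⟩
    (∣ A [ j ]≔ false ∣ + ∣ B [ j ]≔ false ∣) + (count a + count b) ∎
    where
    open ≡.≡-Reasoning
    open import Algebra.Properties.CommutativeSemigroup Data.Nat.Properties.+-commutativeSemigroup using (interchange)

  degree-update₂ : ∀ {n} (s : State n) {k j} → k ≢ j → ∀ x y →
                   degree (update (update s k x) j y) ≡ degree (update (update s k blank) j blank) + (size x + size y)
  degree-update₂ s {k} {j} k≢j x y = begin
    degree (update (update s k x) j y)
      ≡⟨ degree-update (update s k x) j y ⟩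
    degree (update (update s k x) j blank) + size y
      ≡⟨ ≡.cong (λ t → degree t + size y) (update-comm s k≢j x blank) ⟩
    degree (update (update s j blank) k x) + size y
      ≡⟨ ≡.cong (_+ size y) (degree-update (update s j blank) k x) ⟩
    (degree (update (update s j blank) k blank) + size x) + size y
      ≡⟨ ≡.cong (λ t → (degree t + size x) + size y) (≡.sym (update-comm s k≢j blank blank)) ⟩
    (degree cleared + size x) + size y
      ≡⟨ Data.Nat.Properties.+-assoc (degree cleared) (size x) (size y) ⟩
    degree cleared + (size x + size y) ∎
    where
    open ≡.≡-Reasoning
    cleared = update (update s k blank) j blank

  pairSize : Entry × Entry → ℕ
  pairSize (x , y) = size x + size y

  ofDegree? : ∀ r → Decidable (λ xy → pairSize xy ≡ r)
  ofDegree? r xy = pairSize xy Data.Nat.≟ r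

  pairsOfDegree : List Entry → List Entry → ℕ → List (Entry × Entry)
  pairsOfDegree o₁ o₂ r = filter (ofDegree? r) (cartesianProduct o₁ o₂)

  +-≡ᵇ-offset : ∀ m d → (∀ e → (m + e ≡ᵇ d) ≡ false) ⊎ ∃ λ r → ∀ e → (m + e ≡ᵇ d) ≡ (e ≡ᵇ r)
  +-≡ᵇ-offset zero    d       = inj₂ (d , λ _ → ≡.refl)
  +-≡ᵇ-offset (suc m) zero    = inj₁ (λ _ → ≡.refl)
  +-≡ᵇ-offset (suc m) (suc d) = +-≡ᵇ-offset m d

module StateSums {c ℓ : Level} (R : Ring c ℓ) where
  open import Data.List.Membership.Propositional using (_∈_; _∉_)
  open Ring R hiding (zero)
  open Data.Nat using (_≡ᵇ_) renaming (_+_ to _+ℕ_)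
  open FiniteSums R
  open States
  open DistinctLists using (∈-∉⇒≢)
  open import Relation.Binary.Reasoning.Setoid setoid

  private variable
    a : Level
    I : Set a
    n : ℕ

  sumStates : Options n → (State n → Carrier) → Carrier
  sumStates {zero}  O F = F ([] , [])
  sumStates {suc n} O F = ∑ (O zero) (λ x → sumStates (O ∘ suc) (F ∘ (x ∷ₛ_)))

  sumStates-cong-admissible : ∀ (O : Options n) {F G} → (∀ s → Admissible O s → F s ≈ G s) →
                              sumStates O F ≈ sumStates O G
  sumStates-cong-admissible {zero}  O F≈G = F≈G _ (λ ())
  sumStates-cong-admissible {suc n} O F≈G =
    ∑-cong-∈ (O zero) (λ x∈ → sumStates-cong-admissible (O ∘ suc) (λ s adm → F≈G _ (admissible-∷ x∈ adm)))

  sumStates-cong : ∀ (O : Options n) {F G} → (∀ s → F s ≈ G s) → sumStates O F ≈ sumStates O G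
  sumStates-cong O F≈G = sumStates-cong-admissible O (λ s _ → F≈G s)

  sumStates-zero : ∀ (O : Options n) {F} → (∀ s → F s ≈ 0#) → sumStates O F ≈ 0#
  sumStates-zero {zero}  O F≈0 = F≈0 _
  sumStates-zero {suc n} O F≈0 = ∑-zero (O zero) (λ x → sumStates-zero (O ∘ suc) (λ s → F≈0 (x ∷ₛ s)))

  sumStates-− : ∀ (O : Options n) F G → sumStates O (λ s → F s - G s) ≈ sumStates O F - sumStates O G
  sumStates-− {zero}  O F G = refl
  sumStates-− {suc n} O F G = begin
    ∑ (O zero) (λ x → sumStates (O ∘ suc) (λ s → F (x ∷ₛ s) - G (x ∷ₛ s)))
      ≈⟨ ∑-cong (O zero) (λ x → sumStates-− (O ∘ suc) _ _) ⟩
    ∑ (O zero) (λ x → sumStates (O ∘ suc) (F ∘ (x ∷ₛ_)) - sumStates (O ∘ suc) (G ∘ (x ∷ₛ_)))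
      ≈⟨ ∑-+ (O zero) _ _ ⟩
    ∑ (O zero) (λ x → sumStates (O ∘ suc) (F ∘ (x ∷ₛ_))) + ∑ (O zero) (λ x → - sumStates (O ∘ suc) (G ∘ (x ∷ₛ_)))
      ≈⟨ +-congˡ (∑-neg (O zero) _) ⟩
    sumStates O F - sumStates O G ∎

  ∑-sumStates : ∀ (K : List I) (O : Options n) (F : I → State n → Carrier) →
                ∑ K (λ i → sumStates O (F i)) ≈ sumStates O (λ s → ∑ K (λ i → F i s))
  ∑-sumStates {n = zero}  K O F = refl
  ∑-sumStates {n = suc n} K O F = begin
    ∑ K (λ i → ∑ (O zero) (λ x → sumStates (O ∘ suc) (F i ∘ (x ∷ₛ_))))
      ≈⟨ ∑-comm K (O zero) _ ⟩
    ∑ (O zero) (λ x → ∑ K (λ i → sumStates (O ∘ suc) (F i ∘ (x ∷ₛ_))))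
      ≈⟨ ∑-cong (O zero) (λ x → ∑-sumStates K (O ∘ suc) _) ⟩
    ∑ (O zero) (λ x → sumStates (O ∘ suc) (λ s → ∑ K (λ i → F i (x ∷ₛ s)))) ∎

  -- The outer sum over K is what lets sumStates-local₂ apply this to its second coordinate.
  sumStates-local₁ : ∀ (O : Options n) j (K : List I) (F G : I → State n → Carrier) →
    (∀ s → ∑ K (λ i → ∑ (O j) (λ y → F i (update s j y)))
         ≈ ∑ K (λ i → ∑ (O j) (λ y → G i (update s j y)))) →
    ∑ K (λ i → sumStates O (F i)) ≈ ∑ K (λ i → sumStates O (G i))
  -- The entry at j is overwritten by update, so blank is an arbitrary filler.
  sumStates-local₁ {suc n} O zero K F G local =
    trans (pull F) (trans (sumStates-cong (O ∘ suc) (λ s → local (blank ∷ₛ s))) (sym (pull G)))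
    where
    pull : ∀ H → ∑ K (λ i → sumStates O (H i))
                 ≈ sumStates (O ∘ suc) (λ s → ∑ K (λ i → ∑ (O zero) (λ x → H i (x ∷ₛ s))))
    pull H = trans (∑-cong K (λ i → ∑-sumStates (O zero) (O ∘ suc) _)) (∑-sumStates K (O ∘ suc) _)
  sumStates-local₁ {suc n} O (suc j) K F G local = begin
    ∑ K (λ i → ∑ (O zero) (λ x → sumStates (O ∘ suc) (F i ∘ (x ∷ₛ_))))  ≈⟨ ∑-comm K (O zero) _ ⟩
    ∑ (O zero) (λ x → ∑ K (λ i → sumStates (O ∘ suc) (F i ∘ (x ∷ₛ_))))
      ≈⟨ ∑-cong (O zero) (λ x → sumStates-local₁ (O ∘ suc) j K _ _ (λ s → local (x ∷ₛ s))) ⟩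
    ∑ (O zero) (λ x → ∑ K (λ i → sumStates (O ∘ suc) (G i ∘ (x ∷ₛ_))))  ≈⟨ ∑-comm (O zero) K _ ⟩
    ∑ K (λ i → ∑ (O zero) (λ x → sumStates (O ∘ suc) (G i ∘ (x ∷ₛ_)))) ∎

  sumStates-local₂ : ∀ (O : Options n) {k j} → k ≢ j → (F G : State n → Carrier) →
    (∀ s → ∑ (O k) (λ x → ∑ (O j) (λ y → F (update (update s k x) j y)))
         ≈ ∑ (O k) (λ x → ∑ (O j) (λ y → G (update (update s k x) j y)))) →
    sumStates O F ≈ sumStates O G
  sumStates-local₂ {suc n} O {zero}  {zero}  k≢j F G local = ⊥-elim (k≢j ≡.refl)
  sumStates-local₂ {suc n} O {zero}  {suc j} k≢j F G local =
    sumStates-local₁ (O ∘ suc) j (O zero) (λ x → F ∘ (x ∷ₛ_)) (λ x → G ∘ (x ∷ₛ_)) (λ s → local (blank ∷ₛ s))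
  sumStates-local₂ {suc n} O {suc k} {zero}  k≢j F G local =
    sumStates-local₁ (O ∘ suc) k (O zero) (λ y → F ∘ (y ∷ₛ_)) (λ y → G ∘ (y ∷ₛ_))
      (λ s → trans (∑-comm (O zero) (O (suc k)) _) (trans (local (blank ∷ₛ s)) (∑-comm (O (suc k)) (O zero) _)))
  sumStates-local₂ {suc n} O {suc k} {suc j} k≢j F G local =
    ∑-cong (O zero) (λ z → sumStates-local₂ (O ∘ suc) (k≢j ∘ ≡.cong suc) _ _ (λ s → local (z ∷ₛ s)))

  sumStates-restrict : ∀ (O O′ : Options n) →
    (∀ j (f : Entry → Carrier) → (∀ x → x ∉ O j → f x ≈ 0#) → ∑ (O′ j) f ≈ ∑ (O j) f) →
    (F : State n → Carrier) → (∀ s → ¬ Admissible O s → F s ≈ 0#) → sumStates O′ F ≈ sumStates O F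
  sumStates-restrict {zero}  O O′ sub F vanish = refl
  sumStates-restrict {suc n} O O′ sub F vanish = begin
    ∑ (O′ zero) (λ x → sumStates (O′ ∘ suc) (F ∘ (x ∷ₛ_)))
      ≈⟨ sub zero _ (λ x x∉ → sumStates-zero (O′ ∘ suc) (λ s → vanish _ (λ adm → x∉ (adm zero)))) ⟩
    ∑ (O zero) (λ x → sumStates (O′ ∘ suc) (F ∘ (x ∷ₛ_)))
      ≈⟨ ∑-cong-∈ (O zero) (λ x∈ → sumStates-restrict (O ∘ suc) (O′ ∘ suc) (sub ∘ suc) _
                                      (λ s ¬adm → vanish _ (λ adm → ¬adm (adm ∘ suc)))) ⟩
    ∑ (O zero) (λ x → sumStates (O ∘ suc) (F ∘ (x ∷ₛ_))) ∎

  ∑-allSubsets : ∀ n (f : Subset (suc n) → Carrier) →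
                 ∑ (allSubsets (suc n)) f ≈ ∑ (false ∷ true ∷ []) (λ a → ∑ (allSubsets n) (f ∘ (a ∷_)))
  ∑-allSubsets n f = begin
    ∑ (map (false ∷_) S ++ map (true ∷_) S) f           ≈⟨ ∑-++ (map (false ∷_) S) _ f ⟩
    ∑ (map (false ∷_) S) f + ∑ (map (true ∷_) S) f     ≈⟨ +-cong (reflexive (∑-map _ S f)) (reflexive (∑-map _ S f)) ⟩
    ∑ S (f ∘ (false ∷_)) + ∑ S (f ∘ (true ∷_))         ≈⟨ +-congˡ (sym (+-identityʳ _)) ⟩
    ∑ S (f ∘ (false ∷_)) + (∑ S (f ∘ (true ∷_)) + 0#)  ∎
    where S = allSubsets n

  ∑-allSubsets² : ∀ n (F : State n → Carrier) →
                  ∑ (allSubsets n) (λ A → ∑ (allSubsets n) (λ B → F (A , B))) ≈ sumStates (λ _ → allEntries) F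
  ∑-allSubsets² zero    F = trans (+-identityʳ _) (+-identityʳ _)
  ∑-allSubsets² (suc n) F = begin
    ∑ S⁺ (λ A → ∑ S⁺ (λ B → F (A , B)))
      ≈⟨ ∑-cong S⁺ (λ A → ∑-allSubsets n _) ⟩
    ∑ S⁺ (λ A → ∑ bits (λ b → ∑ S (λ B → F (A , b ∷ B))))
      ≈⟨ ∑-allSubsets n _ ⟩
    ∑ bits (λ a → ∑ S (λ A → ∑ bits (λ b → ∑ S (λ B → F (a ∷ A , b ∷ B)))))
      ≈⟨ ∑-cong bits (λ a → ∑-comm S bits (λ A b → ∑ S (λ B → F (a ∷ A , b ∷ B)))) ⟩
    ∑ bits (λ a → ∑ bits (λ b → ∑ S (λ A → ∑ S (λ B → F (a ∷ A , b ∷ B)))))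
      ≈⟨ ∑-cong bits (λ a → ∑-cong bits (λ b → ∑-allSubsets² n (F ∘ ((a , b) ∷ₛ_)))) ⟩
    ∑ bits (λ a → ∑ bits (λ b → sumStates (λ _ → allEntries) (F ∘ ((a , b) ∷ₛ_))))
      ≈⟨ sym (∑-cartesianProduct bits bits (λ x → sumStates (λ _ → allEntries) (F ∘ (x ∷ₛ_)))) ⟩
    sumStates (λ _ → allEntries) F ∎
    where
    S = allSubsets n
    S⁺ = allSubsets (suc n)
    bits = false ∷ true ∷ []

  degreeSum : Options n → ℕ → (State n → Carrier) → Carrier
  degreeSum O d F = sumStates O (λ s → if degree s ≡ᵇ d then F s else 0#)

  degreeSum-cong-admissible : ∀ (O : Options n) d {F G} → (∀ s → Admissible O s → F s ≈ G s) →
                              degreeSum O d F ≈ degreeSum O d G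
  degreeSum-cong-admissible O d F≈G = sumStates-cong-admissible O (λ s adm → if-cong (degree s ≡ᵇ d) (F≈G s adm))
    where
    if-cong : ∀ b {x y} → x ≈ y → (if b then x else 0#) ≈ (if b then y else 0#)
    if-cong true  x≈y = x≈y
    if-cong false x≈y = refl

  degreeSum-cong : ∀ (O : Options n) d {F G} → (∀ s → F s ≈ G s) → degreeSum O d F ≈ degreeSum O d G
  degreeSum-cong O d F≈G = degreeSum-cong-admissible O d (λ s _ → F≈G s)

  GradedIdentity : List Entry → List Entry → (M N : Entry → Entry → Carrier) → Set ℓ
  GradedIdentity o₁ o₂ M N = ∀ r → ∑ (pairsOfDegree o₁ o₂ r) (uncurry M) ≈ ∑ (pairsOfDegree o₁ o₂ r) (uncurry N)

  pointwise⇒graded : ∀ o₁ o₂ {M N} → (∀ {x y} → x ∈ o₁ → y ∈ o₂ → M x y ≈ N x y) →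
                     GradedIdentity o₁ o₂ M N
  pointwise⇒graded o₁ o₂ M≈N r = ∑-cong-∈ (pairsOfDegree o₁ o₂ r) (λ xy∈ →
    let x∈ , y∈ = ∈-cartesianProduct⁻ o₁ o₂ (proj₁ (∈-filter⁻ (ofDegree? r) xy∈))
    in M≈N x∈ y∈)

  graded-offset : ∀ o₁ o₂ {M N} → GradedIdentity o₁ o₂ M N → ∀ m d →
    ∑ (cartesianProduct o₁ o₂) (λ xy → if m +ℕ pairSize xy ≡ᵇ d then uncurry M xy else 0#)
    ≈ ∑ (cartesianProduct o₁ o₂) (λ xy → if m +ℕ pairSize xy ≡ᵇ d then uncurry N xy else 0#)
  graded-offset o₁ o₂ {M} {N} graded m d with +-≡ᵇ-offset m d
  ... | inj₁ never = trans (vanish M) (sym (vanish N))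
    where
    vanish : ∀ P → ∑ (cartesianProduct o₁ o₂) (λ xy → if m +ℕ pairSize xy ≡ᵇ d then uncurry P xy else 0#) ≈ 0#
    vanish P = ∑-zero (cartesianProduct o₁ o₂)
                      (λ xy → reflexive (≡.cong (if_then uncurry P xy else 0#) (never (pairSize xy))))
  ... | inj₂ (r , shift) = trans (component M) (trans (graded r) (sym (component N)))
    where
    component : ∀ P → ∑ (cartesianProduct o₁ o₂) (λ xy → if m +ℕ pairSize xy ≡ᵇ d then uncurry P xy else 0#)
                      ≈ ∑ (pairsOfDegree o₁ o₂ r) (uncurry P)
    component P = trans
      (∑-cong (cartesianProduct o₁ o₂) (λ xy → reflexive (≡.cong (if_then uncurry P xy else 0#) (shift (pairSize xy)))))
      (sym (∑-filter (ofDegree? r) (cartesianProduct o₁ o₂) (uncurry P)))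

  Ignores : Fin n → (State n → Carrier) → Set ℓ
  Ignores j F = ∀ s x → F (update s j x) ≈ F s

  IgnoresAll : List (Fin n) → (State n → Carrier) → Set ℓ
  IgnoresAll js F = ∀ {j} → j ∈ js → Ignores j F

  *-ignores : ∀ {j} {F G : State n → Carrier} → Ignores j F → Ignores j G → Ignores j (λ s → F s * G s)
  *-ignores F-ign G-ign s x = *-cong (F-ign s x) (G-ign s x)

  letter-ignores : ∀ (w : Entry → Carrier) {i j : Fin n} → i ≢ j → Ignores j (λ s → w (entry s i))
  letter-ignores w i≢j s x = reflexive (≡.cong w (entry-update-≢ s i≢j x))

  degreeSum-exchange : ∀ (O : Options n) d {k j} → k ≢ j → {L R′ : State n → Carrier} →
    Ignores k L → Ignores j L → Ignores k R′ → Ignores j R′ →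
    ∀ {M N} → GradedIdentity (O k) (O j) M N →
    degreeSum O d (λ s → L s * (M (entry s k) (entry s j) * R′ s))
    ≈ degreeSum O d (λ s → L s * (N (entry s k) (entry s j) * R′ s))
  degreeSum-exchange O d {k} {j} k≢j {L} {R′} Lk Lj Rk Rj {M} {N} graded =
    sumStates-local₂ O k≢j _ _ (λ s → begin
      _                                                            ≈⟨ factor M s ⟩
      L s * (∑ (cartesianProduct (O k) (O j)) (inner M s) * R′ s)
        ≈⟨ *-congˡ (*-congʳ (graded-offset (O k) (O j) graded (base s) d)) ⟩
      L s * (∑ (cartesianProduct (O k) (O j)) (inner N s) * R′ s)  ≈⟨ factor N s ⟨
      _                                                            ∎)
    where
    base : State _ → ℕ
    base s = degree (update (update s k blank) j blank)

    inner : (Entry → Entry → Carrier) → State _ → Entry × Entry → Carrier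
    inner P s xy = if base s +ℕ pairSize xy ≡ᵇ d then uncurry P xy else 0#

    if-factor : ∀ b {l l′ m r r′} → l ≈ l′ → r ≈ r′ →
                (if b then l * (m * r) else 0#) ≈ l′ * ((if b then m else 0#) * r′)
    if-factor true  l≈l′ r≈r′ = *-cong l≈l′ (*-congˡ r≈r′)
    if-factor false {l′ = l′} {r′ = r′} _ _ = sym (trans (*-congˡ (zeroˡ r′)) (zeroʳ l′))

    term : ∀ P s x y → let t = update (update s k x) j y in
           (if degree t ≡ᵇ d then L t * (P (entry t k) (entry t j) * R′ t) else 0#)
           ≈ L s * (inner P s (x , y) * R′ s)
    term P s x y
      rewrite degree-update₂ s k≢j x y | entry-update-≢ (update s k x) k≢j y
            | entry-update-≡ s k x | entry-update-≡ (update s k x) j y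
      = if-factor (base s +ℕ pairSize (x , y) ≡ᵇ d) (trans (Lj _ y) (Lk s x)) (trans (Rj _ y) (Rk s x))

    factor : ∀ P s → ∑ (O k) (λ x → ∑ (O j) (λ y → let t = update (update s k x) j y in
                        if degree t ≡ᵇ d then L t * (P (entry t k) (entry t j) * R′ t) else 0#))
                     ≈ L s * (∑ (cartesianProduct (O k) (O j)) (inner P s) * R′ s)
    factor P s = begin
      _ ≈⟨ ∑-cong (O k) (λ x → ∑-cong (O j) (λ y → term P s x y)) ⟩
      ∑ (O k) (λ x → ∑ (O j) (λ y → L s * (inner P s (x , y) * R′ s)))
        ≈⟨ ∑-cong (O k) (λ x → trans (sym (∑-distribˡ (O j) (L s) _)) (*-congˡ (sym (∑-distribʳ (O j) (R′ s) _)))) ⟩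
      ∑ (O k) (λ x → L s * (∑ (O j) (λ y → inner P s (x , y)) * R′ s))
        ≈⟨ trans (sym (∑-distribˡ (O k) (L s) _)) (*-congˡ (sym (∑-distribʳ (O k) (R′ s) _))) ⟩
      L s * (∑ (O k) (λ x → ∑ (O j) (λ y → inner P s (x , y))) * R′ s)
        ≈⟨ *-congˡ (*-congʳ (sym (∑-cartesianProduct (O k) (O j) (inner P s)))) ⟩
      L s * (∑ (cartesianProduct (O k) (O j)) (inner P s) * R′ s) ∎

  word : (Fin n → Entry → Carrier) → List (Fin n) → State n → Carrier
  word w is s = ∏ is (λ i → w i (entry s i))

  word-ignores : ∀ (w : Fin n → Entry → Carrier) is {j} → j ∉ is → Ignores j (word w is)
  word-ignores w is j∉is s x =
    ∏-cong-∈ is (λ i∈is → letter-ignores (w _) (∈-∉⇒≢ i∈is j∉is) s x)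

  degreeSum-slide : ∀ (O : Options n) d k (c : Entry → Carrier) (f g : Fin n → Entry → Carrier) zs →
    Unique (k ∷ zs) → {L R′ : State n → Carrier} → IgnoresAll (k ∷ zs) L → IgnoresAll (k ∷ zs) R′ →
    (∀ {j} → j ∈ zs → GradedIdentity (O k) (O j) (λ x y → c x * f j y) (λ x y → g j y * c x)) →
    degreeSum O d (λ s → L s * (c (entry s k) * (word f zs s * R′ s)))
    ≈ degreeSum O d (λ s → L s * (word g zs s * (c (entry s k) * R′ s)))
  degreeSum-slide O d k c f g [] _ _ _ _ =
    degreeSum-cong O d (λ s → *-congˡ (trans (*-congˡ (*-identityˡ _)) (sym (*-identityˡ _))))
  degreeSum-slide O d k c f g (j ∷ zs) ((k≢j ∷ k∉zs) ∷ j∉zs ∷ unique) {L} {R′} L-ign R-ign graded = begin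
    degreeSum O d (λ s → L s * (c (entry s k) * ((f j (entry s j) * word f zs s) * R′ s)))
      ≈⟨ degreeSum-cong O d (λ s → *-congˡ (trans (*-congˡ (*-assoc _ _ _)) (sym (*-assoc _ _ _)))) ⟩
    degreeSum O d (λ s → L s * ((c (entry s k) * f j (entry s j)) * (word f zs s * R′ s)))
      ≈⟨ degreeSum-exchange O d k≢j (L-ign (here ≡.refl)) (L-ign (there (here ≡.refl)))
           (*-ignores (word-ignores f zs (All¬⇒¬Any k∉zs)) (R-ign (here ≡.refl)))
           (*-ignores (word-ignores f zs (All¬⇒¬Any j∉zs)) (R-ign (there (here ≡.refl))))
           (graded (here ≡.refl)) ⟩
    degreeSum O d (λ s → L s * ((g j (entry s j) * c (entry s k)) * (word f zs s * R′ s)))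
      ≈⟨ degreeSum-cong O d (λ s → trans (*-congˡ (*-assoc _ _ _)) (sym (*-assoc _ _ _))) ⟩
    degreeSum O d (λ s → (L s * g j (entry s j)) * (c (entry s k) * (word f zs s * R′ s)))
      ≈⟨ degreeSum-slide O d k c f g zs (k∉zs ∷ unique) L′-ign (R-ign ∘ drop-j) (graded ∘ there) ⟩
    degreeSum O d (λ s → (L s * g j (entry s j)) * (word g zs s * (c (entry s k) * R′ s)))
      ≈⟨ degreeSum-cong O d (λ s → trans (*-assoc _ _ _) (*-congˡ (sym (*-assoc _ _ _)))) ⟩
    degreeSum O d (λ s → L s * ((g j (entry s j) * word g zs s) * (c (entry s k) * R′ s))) ∎
    where
    drop-j : ∀ {i} → i ∈ k ∷ zs → i ∈ k ∷ j ∷ zs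
    drop-j (here i≡k) = here i≡k
    drop-j (there i∈zs) = there (there i∈zs)
    L′-ign : IgnoresAll (k ∷ zs) (λ s → L s * g j (entry s j))
    L′-ign (here ≡.refl) = *-ignores (L-ign (here ≡.refl)) (letter-ignores (g j) (k≢j ∘ ≡.sym))
    L′-ign (there i∈zs)  = *-ignores (L-ign (there (there i∈zs)))
                                     (letter-ignores (g j) (λ j≡i → All.lookup j∉zs i∈zs j≡i))

module CyclicOrder where
  open import Data.List.Membership.Propositional using (_∈_; _∉_)
  open import Data.Fin using (_<_)
  open import Data.Fin.Properties using (_<?_; <-asym; <-irrefl; <⇒≢)
  open import Data.List using (reverse; allFin; [_])
  open import Data.List.Properties using (filter-++; filter-all; filter-none; filter-reject; ++-assoc; ++-identityʳ; unfold-reverse)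
  open import Data.List.Membership.Propositional.Properties using (∈-allFin; ∈-∃++; ∈-++⁻)
  import Data.List.Relation.Unary.All.Properties as All
  import Data.List.Relation.Unary.Any.Properties as Any
  import Data.List.Relation.Unary.AllPairs.Properties as AllPairs
  import Data.List.Relation.Unary.Unique.Propositional.Properties as Unique
  open import Function using (flip)

  private variable
    a r : Level
    A : Set a
    n : ℕ

  AllPairs-reverse : ∀ {R : A → A → Set r} {xs} → AllPairs R xs → AllPairs (flip R) (reverse xs)
  AllPairs-reverse {xs = []}     []            = []
  AllPairs-reverse {R = R} {x ∷ xs} (Rx ∷ Rxs) =
    ≡.subst (AllPairs (flip R)) (≡.sym (unfold-reverse x xs))
      (AllPairs.++⁺ (AllPairs-reverse Rxs) ([] ∷ []) (All.tabulate (λ y∈ → All.lookup Rx (Any.reverse⁻ y∈) ∷ [])))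

  AllPairs-split : ∀ {R : A → A → Set r} xs {y zs} → AllPairs R (xs ++ y ∷ zs) → All (flip R y) xs × All (R y) zs
  AllPairs-split []       (Ry ∷ _)    = [] , Ry
  AllPairs-split (x ∷ xs) (Rx ∷ Rxs) =
    let before , after = AllPairs-split xs Rxs in All.head (All.++⁻ʳ xs Rx) ∷ before , after

  descending : AllPairs (flip _<_) (reverse (allFin n))
  descending = AllPairs-reverse (AllPairs.tabulate⁺-< (λ i<j → i<j))

  cycOrder-split : ∀ (c : Fin n) xs zs → reverse (allFin n) ≡ xs ++ c ∷ zs → cycOrder c ≡ zs ++ xs
  cycOrder-split c xs zs eq
    with above , below ← AllPairs-split xs (≡.subst (AllPairs (flip _<_)) eq descending) = begin
    cycOrder c
      ≡⟨ ≡.cong (λ R → filter (_<? c) R ++ filter (c <?_) R) eq ⟩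
    filter (_<? c) (xs ++ c ∷ zs) ++ filter (c <?_) (xs ++ c ∷ zs)
      ≡⟨ ≡.cong₂ _++_ (filter-++ (_<? c) xs (c ∷ zs)) (filter-++ (c <?_) xs (c ∷ zs)) ⟩
    (filter (_<? c) xs ++ filter (_<? c) (c ∷ zs)) ++ (filter (c <?_) xs ++ filter (c <?_) (c ∷ zs))
      ≡⟨ ≡.cong₂ _++_
           (≡.cong₂ _++_ (filter-none (_<? c) (All.map (flip <-asym) above))
                         (≡.trans (filter-reject (_<? c) (<-irrefl ≡.refl)) (filter-all (_<? c) below)))
           (≡.cong₂ _++_ (filter-all (c <?_) above)
                         (≡.trans (filter-reject (c <?_) (<-irrefl ≡.refl)) (filter-none (c <?_) (All.map (flip <-asym) below)))) ⟩
    zs ++ (xs ++ [])  ≡⟨ ≡.cong (zs ++_) (++-identityʳ xs) ⟩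
    zs ++ xs ∎
    where open ≡.≡-Reasoning

  cycOrder-unique : ∀ (c : Fin n) → Unique (cycOrder c)
  cycOrder-unique {n} c = Unique.++⁺ (Unique.filter⁺ (_<? c) distinct) (Unique.filter⁺ (c <?_) distinct) disjoint
    where
    distinct : Unique (reverse (allFin n))
    distinct = AllPairs.map (λ j<i i≡j → <⇒≢ j<i (≡.sym i≡j)) descending
    disjoint : ∀ {i} → ¬ (i ∈ filter (_<? c) (reverse (allFin n)) × i ∈ filter (c <?_) (reverse (allFin n)))
    disjoint (i∈below , i∈above) = <-asym (proj₂ (∈-filter⁻ (_<? c) {xs = reverse (allFin n)} i∈below))
                                          (proj₂ (∈-filter⁻ (c <?_) {xs = reverse (allFin n)} i∈above))

  cycOrder-∌ : ∀ (c : Fin n) → c ∉ cycOrder c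
  cycOrder-∌ {n} c c∈ with ∈-++⁻ (filter (_<? c) (reverse (allFin n))) c∈
  ... | inj₁ c∈below = <-irrefl ≡.refl (proj₂ (∈-filter⁻ (_<? c) {xs = reverse (allFin n)} c∈below))
  ... | inj₂ c∈above = <-irrefl ≡.refl (proj₂ (∈-filter⁻ (c <?_) {xs = reverse (allFin n)} c∈above))

  record CyclicSplit (p q : Fin n) : Set where
    field
      between beyond : List (Fin n)
      cycOrder-p : cycOrder p ≡ between ++ q ∷ beyond
      cycOrder-q : cycOrder q ≡ beyond ++ p ∷ between

  CyclicSplit-sym : ∀ {p q : Fin n} → CyclicSplit p q → CyclicSplit q p
  CyclicSplit-sym split = record { between = beyond ; beyond = between ; cycOrder-p = cycOrder-q ; cycOrder-q = cycOrder-p }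
    where open CyclicSplit split

  rotate : ∀ {p q : Fin n} xs ys zs → reverse (allFin n) ≡ xs ++ p ∷ ys ++ q ∷ zs → CyclicSplit p q
  rotate {p = p} {q} xs ys zs eq = record
    { between = ys
    ; beyond = zs ++ xs
    ; cycOrder-p = ≡.trans (cycOrder-split p xs (ys ++ q ∷ zs) eq) (++-assoc ys (q ∷ zs) xs)
    ; cycOrder-q = ≡.trans (cycOrder-split q (xs ++ p ∷ ys) zs (≡.trans eq (≡.sym (++-assoc xs (p ∷ ys) (q ∷ zs)))))
                           (≡.sym (++-assoc zs xs (p ∷ ys)))
    }

  cyclicSplit : ∀ {p q : Fin n} → p ≢ q → CyclicSplit p q
  cyclicSplit {n} {p} {q} p≢q with xs , zs , eq ← ∈-∃++ (Any.reverse⁺ (∈-allFin {n} p))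
    with ∈-++⁻ xs (≡.subst (q ∈_) eq (Any.reverse⁺ (∈-allFin q)))
  ... | inj₂ (here q≡p)  = ⊥-elim (p≢q (≡.sym q≡p))
  ... | inj₂ (there q∈zs) with ys , zs′ , ≡.refl ← ∈-∃++ q∈zs = rotate xs ys zs′ eq
  ... | inj₁ q∈xs with xs′ , ys , ≡.refl ← ∈-∃++ q∈xs =
    CyclicSplit-sym (rotate xs′ ys zs (≡.trans eq (++-assoc xs′ (q ∷ ys) (p ∷ zs))))

module Coordinates {n : ℕ} (X : Subset n) {p q : Fin n} (p≢q : p ≢ q) (p∉X : p ∉ₛ X) (q∉X : q ∉ₛ X) where
  open import Data.List.Membership.Propositional using (_∈_; _∉_)
  open States
  open import Data.Bool using (_≟_)
  open import Data.Fin.Properties using () renaming (_≟_ to _≟ᶠ_)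
  open import Data.Fin.Subset.Properties using (_∈?_; x∈p∪q⁺; x∈p∪q⁻; x∈⁅x⁆; x∈⁅y⁆⇒x≡y)
  open import Data.Vec.Properties using (lookup⇒[]=; []=⇒lookup)
  open import Relation.Nullary.Decidable using (_×-dec_; _⊎-dec_)

  data Kind : Set where
    isP isQ inX other : Kind

  -- An entry (j ∈ A , j ∈ B) is allowed when A ⊆ X ∪ {q}, B ⊆ X ∪ {p} and X ⊆ A ∪ B hold at j.
  Allowed : Kind → Entry → Set
  Allowed isP   (a , b) = a ≡ false
  Allowed isQ   (a , b) = b ≡ false
  Allowed inX   (a , b) = a ≡ true ⊎ b ≡ true
  Allowed other (a , b) = a ≡ false × b ≡ false

  allowed? : ∀ k → Decidable (Allowed k)
  allowed? isP   (a , b) = a ≟ false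
  allowed? isQ   (a , b) = b ≟ false
  allowed? inX   (a , b) = a ≟ true ⊎-dec b ≟ true
  allowed? other (a , b) = a ≟ false ×-dec b ≟ false

  options : Kind → List Entry
  options k = filter (allowed? k) allEntries

  ∈-options⁺ : ∀ {k x} → Allowed k x → x ∈ options k
  ∈-options⁺ {k} {x} = ∈-filter⁺ (allowed? k) (∈-allEntries x)

  ∈-options⁻ : ∀ {k x} → x ∈ options k → Allowed k x
  ∈-options⁻ {k} x∈ = proj₂ (∈-filter⁻ (allowed? k) {xs = allEntries} x∈)

  kind : Fin n → Kind
  kind j with j ≟ᶠ p | j ≟ᶠ q | j ∈? X
  ... | yes _ | _     | _     = isP
  ... | no _  | yes _ | _     = isQ
  ... | no _  | no _  | yes _ = inX
  ... | no _  | no _  | no _  = other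

  KindSpec : Fin n → Kind → Set
  KindSpec j isP   = j ≡ p
  KindSpec j isQ   = j ≡ q
  KindSpec j inX   = j ∈ₛ X
  KindSpec j other = j ≢ p × j ≢ q × j ∉ₛ X

  kind-spec : ∀ j → KindSpec j (kind j)
  kind-spec j with j ≟ᶠ p | j ≟ᶠ q | j ∈? X
  ... | yes j≡p | _       | _       = j≡p
  ... | no _    | yes j≡q | _       = j≡q
  ... | no _    | no _    | yes j∈X = j∈X
  ... | no j≢p  | no j≢q  | no j∉X  = j≢p , j≢q , j∉X

  kind-p : kind p ≡ isP
  kind-p with kind p | kind-spec p
  ... | isP   | _             = ≡.refl
  ... | isQ   | p≡q           = ⊥-elim (p≢q p≡q)
  ... | inX   | p∈X           = ⊥-elim (p∉X p∈X)
  ... | other | p≢p , _ , _   = ⊥-elim (p≢p ≡.refl)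

  kind-q : kind q ≡ isQ
  kind-q with kind q | kind-spec q
  ... | isP   | q≡p           = ⊥-elim (p≢q (≡.sym q≡p))
  ... | isQ   | _             = ≡.refl
  ... | inX   | q∈X           = ⊥-elim (q∉X q∈X)
  ... | other | _ , q≢q , _   = ⊥-elim (q≢q ≡.refl)

  kind-X : ∀ {j} → j ∈ₛ X → kind j ≡ inX
  kind-X {j} j∈X with kind j | kind-spec j
  ... | isP   | ≡.refl        = ⊥-elim (p∉X j∈X)
  ... | isQ   | ≡.refl        = ⊥-elim (q∉X j∈X)
  ... | inX   | _             = ≡.refl
  ... | other | _ , _ , j∉X   = ⊥-elim (j∉X j∈X)

  O : Options n
  O j = options (kind j)

  lookup-∉ : ∀ {m} (A : Subset m) {i} → i ∉ₛ A → lookup A i ≡ false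
  lookup-∉ A {i} i∉A with lookup A i in eq
  ... | true  = ⊥-elim (i∉A (lookup⇒[]= i A eq))
  ... | false = ≡.refl

  occupied-A : ∀ {A B : Subset n} {i} → Allowed (kind i) (lookup A i , lookup B i) → lookup A i ≡ true → i ≢ q → i ∈ₛ X
  occupied-A {A} {B} {i} allowed a≡true i≢q with kind i | kind-spec i
  ... | isP   | ≡.refl      = case ≡.trans (≡.sym a≡true) allowed of λ ()
  ... | isQ   | i≡q         = ⊥-elim (i≢q i≡q)
  ... | inX   | i∈X         = i∈X
  ... | other | _           = case ≡.trans (≡.sym a≡true) (proj₁ allowed) of λ ()

  occupied-B : ∀ {A B : Subset n} {i} → Allowed (kind i) (lookup A i , lookup B i) → lookup B i ≡ true → i ≢ p → i ∈ₛ X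
  occupied-B {A} {B} {i} allowed b≡true i≢p with kind i | kind-spec i
  ... | isP   | i≡p         = ⊥-elim (i≢p i≡p)
  ... | isQ   | ≡.refl      = case ≡.trans (≡.sym b≡true) allowed of λ ()
  ... | inX   | i∈X         = i∈X
  ... | other | _           = case ≡.trans (≡.sym b≡true) (proj₂ allowed) of λ ()

  Supported : State n → Set
  Supported (A , B) = X ⊆ A ∪ B × A ∪ B ⊆ X ∪ (⁅ p ⁆ ∪ ⁅ q ⁆) × p ∉ₛ A × q ∉ₛ B

  supported⇒admissible : ∀ s → Supported s → Admissible O s
  supported⇒admissible (A , B) (X⊆A∪B , A∪B⊆ , p∉A , q∉B) j = ∈-options⁺ (allowed j)
    where
    outside : ∀ {j} → j ≢ p → j ≢ q → j ∉ₛ X → j ∉ₛ A ∪ B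
    outside j≢p j≢q j∉X j∈A∪B with x∈p∪q⁻ X _ (A∪B⊆ j∈A∪B)
    ... | inj₁ j∈X = j∉X j∈X
    ... | inj₂ j∈pq with x∈p∪q⁻ ⁅ p ⁆ ⁅ q ⁆ j∈pq
    ...   | inj₁ j∈p = j≢p (x∈⁅y⁆⇒x≡y p j∈p)
    ...   | inj₂ j∈q = j≢q (x∈⁅y⁆⇒x≡y q j∈q)
    allowed : ∀ j → Allowed (kind j) (lookup A j , lookup B j)
    allowed j with kind j | kind-spec j
    ... | isP   | ≡.refl = lookup-∉ A p∉A
    ... | isQ   | ≡.refl = lookup-∉ B q∉B
    ... | inX   | j∈X with x∈p∪q⁻ A B (X⊆A∪B j∈X)
    ...   | inj₁ j∈A = inj₁ ([]=⇒lookup j∈A)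
    ...   | inj₂ j∈B = inj₂ ([]=⇒lookup j∈B)
    allowed j | other | j≢p , j≢q , j∉X =
        lookup-∉ A (outside j≢p j≢q j∉X ∘ x∈p∪q⁺ ∘ inj₁)
      , lookup-∉ B (outside j≢p j≢q j∉X ∘ x∈p∪q⁺ ∘ inj₂)

  admissible⇒supported : ∀ s → Admissible O s → Supported s
  admissible⇒supported (A , B) adm = X⊆A∪B , A∪B⊆ , p∉A , q∉B
    where
    allowed : ∀ j → Allowed (kind j) (lookup A j , lookup B j)
    allowed j = ∈-options⁻ (adm j)
    X⊆A∪B : X ⊆ A ∪ B
    X⊆A∪B {j} j∈X with kind j | kind-X j∈X | allowed j
    ... | _ | ≡.refl | inj₁ a≡true = x∈p∪q⁺ (inj₁ (lookup⇒[]= j A a≡true))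
    ... | _ | ≡.refl | inj₂ b≡true = x∈p∪q⁺ (inj₂ (lookup⇒[]= j B b≡true))
    A∪B⊆ : A ∪ B ⊆ X ∪ (⁅ p ⁆ ∪ ⁅ q ⁆)
    A∪B⊆ {j} j∈A∪B with kind j | kind-spec j | allowed j
    ... | isP   | ≡.refl | _ = x∈p∪q⁺ (inj₂ (x∈p∪q⁺ (inj₁ (x∈⁅x⁆ p))))
    ... | isQ   | ≡.refl | _ = x∈p∪q⁺ (inj₂ (x∈p∪q⁺ (inj₂ (x∈⁅x⁆ q))))
    ... | inX   | j∈X    | _ = x∈p∪q⁺ (inj₁ j∈X)
    ... | other | _      | a≡false , b≡false with x∈p∪q⁻ A B j∈A∪B
    ...   | inj₁ j∈A = case ≡.trans (≡.sym ([]=⇒lookup j∈A)) a≡false of λ ()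
    ...   | inj₂ j∈B = case ≡.trans (≡.sym ([]=⇒lookup j∈B)) b≡false of λ ()
    p∉A : p ∉ₛ A
    p∉A p∈A with kind p | kind-p | allowed p
    ... | _ | ≡.refl | a≡false = case ≡.trans (≡.sym ([]=⇒lookup p∈A)) a≡false of λ ()
    q∉B : q ∉ₛ B
    q∉B q∈B with kind q | kind-q | allowed q
    ... | _ | ≡.refl | b≡false = case ≡.trans (≡.sym ([]=⇒lookup q∈B)) b≡false of λ ()

module CommutatorSum {c ℓ : Level} (R : Ring c ℓ) {n : ℕ} (X : Subset n) {p q : Fin n} (p≢q : p ≢ q)
    (p∉X : p ∉ₛ X) (q∉X : q ∉ₛ X) (unp pr : Fin n → Ring.Carrier R) (star : Ring.Carrier R)
    (rels : Relations R X p q unp pr star) where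
  open import Data.List.Membership.Propositional using (_∈_; _∉_)
  open Ring R hiding (zero)
  open import Algebra.Properties.Ring R
    using (-‿involutive; -‿distribˡ-*; -‿distribʳ-*; x[y-z]≈xy-xz; [y-z]x≈yx-zx; -0#≈0#; x≈y⇒x∙y⁻¹≈ε)
  open import Relation.Binary.Reasoning.Setoid setoid
  open FiniteSums R
  open States
  open StateSums R
  open Coordinates X p≢q p∉X q∉X
  open DistinctLists
  open CyclicOrder
  open Relations rels

  û v̂ : Fin n → Entry → Carrier
  û i (a , b) = if a then unp i else 1#
  v̂ i (a , b) = if b then pr i else 1#

  vacant : Entry → Carrier
  vacant (false , false) = 1#
  vacant (false , true)  = 0#
  vacant (true  , _)     = 0#

  letter-commute : ∀ s → Admissible O s → ∀ {i j} → i ≢ j → i ≢ q → j ≢ p →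
                   û i (entry s i) * v̂ j (entry s j) ≈ v̂ j (entry s j) * û i (entry s i)
  letter-commute (A , B) adm {i} {j} i≢j i≢q j≢p with lookup A i in a≡true | lookup B j in b≡true
  ... | false | _     = trans (*-identityˡ _) (sym (*-identityʳ _))
  ... | true  | false = trans (*-identityʳ _) (sym (*-identityˡ _))
  ... | true  | true  =
    rel-ij' i j (occupied-A {A} {B} (∈-options⁻ (adm i)) a≡true i≢q)
                (occupied-B {A} {B} (∈-options⁻ (adm j)) b≡true j≢p) i≢j

  module Exchange {a b c : Carrier} (c²≈0 : c * c ≈ 0#)
                  (ab≈ : a * b ≈ b * c - c * a) (ba≈ : b * a ≈ c * b - a * c) where

    private
      cancel : ∀ x y z → (x - y) + (y + z) ≈ x + z
      cancel x y z = begin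
        (x - y) + (y + z)  ≈⟨ +-assoc x (- y) (y + z) ⟩
        x + (- y + (y + z)) ≈⟨ +-congˡ (sym (+-assoc (- y) y z)) ⟩
        x + ((- y + y) + z) ≈⟨ +-congˡ (+-congʳ (-‿inverseˡ y)) ⟩
        x + (0# + z)        ≈⟨ +-congˡ (+-identityˡ z) ⟩
        x + z               ∎

      minus-zero : ∀ {x y} → y ≈ 0# → x - y ≈ x
      minus-zero y≈0 = trans (+-congˡ (trans (-‿cong y≈0) -0#≈0#)) (+-identityʳ _)

    exchange₂ : a * b + (c * a + c * b) ≈ b * a + (a * c + b * c)
    exchange₂ = begin
      a * b + (c * a + c * b)            ≈⟨ +-congʳ ab≈ ⟩
      (b * c - c * a) + (c * a + c * b)  ≈⟨ cancel _ _ _ ⟩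
      b * c + c * b                      ≈⟨ +-comm _ _ ⟩
      c * b + b * c                      ≈⟨ cancel _ _ _ ⟨
      (c * b - a * c) + (a * c + b * c)  ≈⟨ +-congʳ ba≈ ⟨
      b * a + (a * c + b * c)            ∎

    exchange₃ : c * (a * b) ≈ (b * a) * c
    exchange₃ = begin
      c * (a * b)                  ≈⟨ *-congˡ ab≈ ⟩
      c * (b * c - c * a)          ≈⟨ x[y-z]≈xy-xz c _ _ ⟩
      c * (b * c) - c * (c * a)    ≈⟨ minus-zero (trans (sym (*-assoc c c a)) (trans (*-congʳ c²≈0) (zeroˡ a))) ⟩
      c * (b * c)                  ≈⟨ *-assoc c b c ⟨
      (c * b) * c                  ≈⟨ minus-zero (trans (*-assoc a c c) (trans (*-congˡ c²≈0) (zeroʳ a))) ⟨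
      (c * b) * c - (a * c) * c    ≈⟨ [y-z]x≈yx-zx c _ _ ⟨
      (c * b - a * c) * c          ≈⟨ *-congʳ ba≈ ⟨
      (b * a) * c                  ∎

  -- Relation (1) makes q = -* and p′ = *; substituting into (3) gives the hypotheses of Exchange.
  star≈-q : star ≈ - unp q
  star≈-q = sym rel-q

  q²≈0 : unp q * unp q ≈ 0#
  q²≈0 = begin
    unp q * unp q              ≈⟨ -‿involutive _ ⟨
    - - (unp q * unp q)        ≈⟨ -‿cong (-‿distribʳ-* (unp q) (unp q)) ⟩
    - (unp q * - unp q)        ≈⟨ -‿distribˡ-* (unp q) (- unp q) ⟩
    (- unp q) * (- unp q)      ≈⟨ *-cong star≈-q star≈-q ⟨
    star * star                ≈⟨ rel-star ⟩
    0#                         ∎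

  p′²≈0 : pr p * pr p ≈ 0#
  p′²≈0 = trans (*-cong rel-p' rel-p') rel-star

  star-*ˡ : ∀ x → star * x ≈ - (unp q * x)
  star-*ˡ x = trans (*-congʳ star≈-q) (sym (-‿distribˡ-* (unp q) x))

  star-*ʳ : ∀ x → x * star ≈ - (x * unp q)
  star-*ʳ x = trans (*-congˡ star≈-q) (sym (-‿distribʳ-* x (unp q)))

  negate-both : ∀ {x x′ y y′} → x ≈ - x′ → y ≈ - y′ → x - y ≈ y′ - x′
  negate-both x≈ y≈ = trans (+-cong x≈ (-‿cong y≈)) (trans (+-congˡ (-‿involutive _)) (+-comm _ _))

  module ExchangeQ {j} (j∈X : j ∈ₛ X) = Exchange {unp j} {pr j} {unp q} q²≈0
    (trans (rel-ii' j j∈X) (negate-both (star-*ˡ (unp j)) (star-*ʳ (pr j))))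
    (trans (rel-i'i j j∈X) (negate-both (star-*ʳ (unp j)) (star-*ˡ (pr j))))

  module ExchangeP {j} (j∈X : j ∈ₛ X) = Exchange {pr j} {unp j} {pr p} p′²≈0
    (trans (rel-i'i j j∈X) (+-cong (*-congˡ (sym rel-p')) (-‿cong (*-congʳ (sym rel-p')))))
    (trans (rel-ii' j j∈X) (+-cong (*-congʳ (sym rel-p')) (-‿cong (*-congˡ (sym rel-p')))))

  private
    1*[1*x]≈x : ∀ x → 1# * (1# * x) ≈ x
    1*[1*x]≈x x = trans (*-identityˡ _) (*-identityˡ x)
    1*[x*1]≈x : ∀ x → 1# * (x * 1#) ≈ x
    1*[x*1]≈x x = trans (*-identityˡ _) (*-identityʳ x)
    [x*1]*1≈x : ∀ x → (x * 1#) * 1# ≈ x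
    [x*1]*1≈x x = trans (*-identityʳ _) (*-identityʳ x)
    [1*x]*1≈x : ∀ x → (1# * x) * 1# ≈ x
    [1*x]*1≈x x = trans (*-identityʳ _) (*-identityˡ x)
    +-identityʳ-tail : ∀ {x x′ y y′} → x ≈ x′ → y ≈ y′ → x + (y + 0#) ≈ x′ + y′
    +-identityʳ-tail x≈ y≈ = +-cong x≈ (trans (+-identityʳ _) y≈)

  -- For each literal degree, pairsOfDegree computes to an explicit list, so every clause below is a
  -- finite ring identity; degrees beyond the largest entry sizes give empty sums.
  slide-q-X : ∀ {j} → j ∈ₛ X → GradedIdentity (options isQ) (options inX)
                (λ x y → û q x * (û j y * v̂ j y)) (λ x y → (v̂ j y * û j y) * û q x)
  slide-q-X j∈X 0 = refl
  slide-q-X {j} j∈X 1 = +-cong (trans (1*[1*x]≈x (pr j)) (sym ([x*1]*1≈x (pr j))))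
                              (+-congʳ (trans (1*[x*1]≈x (unp j)) (sym ([1*x]*1≈x (unp j)))))
  slide-q-X {j} j∈X 2 = begin
    1# * (u * v) + (w * (1# * v) + (w * (u * 1#) + 0#))
      ≈⟨ +-cong (*-identityˡ _) (+-identityʳ-tail (*-congˡ (*-identityˡ v)) (*-congˡ (*-identityʳ u))) ⟩
    u * v + (w * v + w * u)  ≈⟨ +-congˡ (+-comm _ _) ⟩
    u * v + (w * u + w * v)  ≈⟨ exchange₂ ⟩
    v * u + (u * w + v * w)  ≈⟨ +-congˡ (+-comm _ _) ⟩
    v * u + (v * w + u * w)
      ≈⟨ +-cong (*-identityʳ _) (+-identityʳ-tail (*-congʳ (*-identityʳ v)) (*-congʳ (*-identityˡ u))) ⟨
    (v * u) * 1# + ((v * 1#) * w + ((1# * u) * w + 0#)) ∎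
    where
    open ExchangeQ j∈X
    u = unp j
    v = pr j
    w = unp q
  slide-q-X j∈X 3 = +-congʳ (ExchangeQ.exchange₃ j∈X)
  slide-q-X j∈X (suc (suc (suc (suc r)))) = refl

  slide-p-X : ∀ {j} → j ∈ₛ X → GradedIdentity (options isP) (options inX)
                (λ x y → v̂ p x * (v̂ j y * û j y)) (λ x y → (û j y * v̂ j y) * v̂ p x)
  slide-p-X j∈X 0 = refl
  slide-p-X {j} j∈X 1 = +-cong (trans (1*[x*1]≈x (pr j)) (sym ([1*x]*1≈x (pr j))))
                              (+-congʳ (trans (1*[1*x]≈x (unp j)) (sym ([x*1]*1≈x (unp j)))))
  slide-p-X {j} j∈X 2 = begin
    1# * (v * u) + (σ * (v * 1#) + (σ * (1# * u) + 0#))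
      ≈⟨ +-cong (*-identityˡ _) (+-identityʳ-tail (*-congˡ (*-identityʳ v)) (*-congˡ (*-identityˡ u))) ⟩
    v * u + (σ * v + σ * u)  ≈⟨ exchange₂ ⟩
    u * v + (v * σ + u * σ)
      ≈⟨ +-cong (*-identityʳ _) (+-identityʳ-tail (*-congʳ (*-identityˡ v)) (*-congʳ (*-identityʳ u))) ⟨
    (u * v) * 1# + ((1# * v) * σ + ((u * 1#) * σ + 0#)) ∎
    where
    open ExchangeP j∈X
    u = unp j
    v = pr j
    σ = pr p
  slide-p-X j∈X 3 = +-congʳ (ExchangeP.exchange₃ j∈X)
  slide-p-X j∈X (suc (suc (suc (suc r)))) = refl

  p′+q≈0 : pr p + unp q ≈ 0#
  p′+q≈0 = trans (+-congʳ (trans rel-p' star≈-q)) (-‿inverseˡ (unp q))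

  q*p′≈0 : unp q * pr p ≈ 0#
  q*p′≈0 = trans (*-congˡ rel-p') (trans (star-*ʳ (unp q)) (trans (-‿cong q²≈0) -0#≈0#))

  p′*q≈0 : pr p * unp q ≈ 0#
  p′*q≈0 = trans (*-congʳ rel-p') (trans (star-*ˡ (unp q)) (trans (-‿cong q²≈0) -0#≈0#))

  private
    vacant-terms₁ : 1# * 0# + (0# * 1# + 0#) ≈ 0#
    vacant-terms₁ = trans (+-cong (zeroʳ 1#) (trans (+-identityʳ _) (zeroˡ 1#))) (+-identityʳ 0#)
    vacant-terms₂ : 0# * 0# + 0# ≈ 0#
    vacant-terms₂ = trans (+-identityʳ _) (zeroˡ 0#)

  annihilate-q-p : GradedIdentity (options isQ) (options isP) (λ x y → û q x * v̂ p y) (λ x y → vacant x * vacant y)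
  annihilate-q-p 0 = refl
  annihilate-q-p 1 = trans (+-cong (*-identityˡ _) (trans (+-identityʳ _) (*-identityʳ _)))
                           (trans p′+q≈0 (sym vacant-terms₁))
  annihilate-q-p 2 = trans (+-identityʳ _) (trans q*p′≈0 (sym vacant-terms₂))
  annihilate-q-p (suc (suc (suc r))) = refl

  annihilate-p-q : GradedIdentity (options isP) (options isQ) (λ x y → v̂ p x * û q y) (λ x y → vacant x * vacant y)
  annihilate-p-q 0 = refl
  annihilate-p-q 1 = trans (+-cong (*-identityˡ _) (trans (+-identityʳ _) (*-identityʳ _)))
                           (trans (+-comm _ _) (trans p′+q≈0 (sym vacant-terms₁)))
  annihilate-p-q 2 = trans (+-identityʳ _) (trans p′*q≈0 (sym vacant-terms₂))
  annihilate-p-q (suc (suc (suc r))) = refl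

  ∈-other : ∀ {y} → y ∈ options other → y ≡ blank
  ∈-other {a , b} y∈ with ∈-options⁻ {other} y∈
  ... | ≡.refl , ≡.refl = ≡.refl

  1*1-central : ∀ x → x * (1# * 1#) ≈ (1# * 1#) * x
  1*1-central x = trans (*-congˡ (*-identityˡ 1#))
                        (trans (*-identityʳ x) (sym (trans (*-congʳ (*-identityˡ 1#)) (*-identityˡ x))))

  graded-at-kinds : ∀ {i j k k′ M N} → kind i ≡ k → kind j ≡ k′ →
                    GradedIdentity (options k) (options k′) M N → GradedIdentity (O i) (O j) M N
  graded-at-kinds ≡.refl ≡.refl graded = graded

  slide-q : ∀ {j} → j ≢ q → j ≢ p → GradedIdentity (O q) (O j)
              (λ x y → û q x * (û j y * v̂ j y)) (λ x y → (v̂ j y * û j y) * û q x)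
  slide-q {j} j≢q j≢p = graded-at-kinds {j = j} kind-q ≡.refl (by-kind (kind j) (kind-spec j))
    where
    by-kind : ∀ k → KindSpec j k → GradedIdentity (options isQ) (options k)
                (λ x y → û q x * (û j y * v̂ j y)) (λ x y → (v̂ j y * û j y) * û q x)
    by-kind isP   j≡p = ⊥-elim (j≢p j≡p)
    by-kind isQ   j≡q = ⊥-elim (j≢q j≡q)
    by-kind inX   j∈X = slide-q-X j∈X
    by-kind other _   = pointwise⇒graded (options isQ) (options other) (λ {x} _ y∈ →
      ≡.subst (λ y → û q x * (û j y * v̂ j y) ≈ (v̂ j y * û j y) * û q x) (≡.sym (∈-other y∈)) (1*1-central (û q x)))

  slide-p : ∀ {j} → j ≢ p → j ≢ q → GradedIdentity (O p) (O j)
              (λ x y → v̂ p x * (v̂ j y * û j y)) (λ x y → (û j y * v̂ j y) * v̂ p x)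
  slide-p {j} j≢p j≢q = graded-at-kinds {j = j} kind-p ≡.refl (by-kind (kind j) (kind-spec j))
    where
    by-kind : ∀ k → KindSpec j k → GradedIdentity (options isP) (options k)
                (λ x y → v̂ p x * (v̂ j y * û j y)) (λ x y → (û j y * v̂ j y) * v̂ p x)
    by-kind isP   j≡p = ⊥-elim (j≢p j≡p)
    by-kind isQ   j≡q = ⊥-elim (j≢q j≡q)
    by-kind inX   j∈X = slide-p-X j∈X
    by-kind other _   = pointwise⇒graded (options isP) (options other) (λ {x} _ y∈ →
      ≡.subst (λ y → v̂ p x * (v̂ j y * û j y) ≈ (û j y * v̂ j y) * v̂ p x) (≡.sym (∈-other y∈)) (1*1-central (v̂ p x)))

  annihilate-q : GradedIdentity (O q) (O p) (λ x y → û q x * v̂ p y) (λ x y → vacant x * vacant y)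
  annihilate-q = graded-at-kinds kind-q kind-p annihilate-q-p

  annihilate-p : GradedIdentity (O p) (O q) (λ x y → v̂ p x * û q y) (λ x y → vacant x * vacant y)
  annihilate-p = graded-at-kinds kind-p kind-q annihilate-p-q

  module HalfReduction (f g : Fin n → Entry → Carrier) {a b : Fin n} (M N : List (Fin n))
              (unique : Unique (M ++ a ∷ N)) (b∉ : b ∉ M ++ a ∷ N)
              (commute : ∀ s → Admissible O s → ∀ {i j} → i ≢ j → i ≢ a → j ≢ b →
                         f i (entry s i) * g j (entry s j) ≈ g j (entry s j) * f i (entry s i))
              (slide : ∀ {j} → j ≢ a → j ≢ b →
                       GradedIdentity (O a) (O j) (λ x y → f a x * (f j y * g j y)) (λ x y → (g j y * f j y) * f a x))
              (annihilate : GradedIdentity (O a) (O b) (λ x y → f a x * g b y) (λ x y → vacant x * vacant y)) where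

    fg gf : Fin n → Entry → Carrier
    fg i x = f i x * g i x
    gf i x = g i x * f i x

    private
      aN-unique : Unique (a ∷ N)
      aN-unique = proj₁ (proj₂ (Unique-++⁻ M unique))
      M∌aN : ∀ {x} → x ∈ M → x ∉ a ∷ N
      M∌aN = proj₂ (proj₂ (Unique-++⁻ M unique))
      N-unique : Unique N
      N-unique = AllPairs.tail aN-unique
      a∉N : a ∉ N
      a∉N = All¬⇒¬Any (AllPairs.head aN-unique)
      a∉M : a ∉ M
      a∉M a∈M = M∌aN a∈M (here ≡.refl)
      b∉M : b ∉ M
      b∉M = b∉ ∘ ∈-++⁺ˡ
      b∉aN : b ∉ a ∷ N
      b∉aN = b∉ ∘ ∈-++⁺ʳ M

      N-commute : ∀ s → Admissible O s → ∀ {i j} → i ∈ N → j ∈ N → i ≢ j →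
                  f i (entry s i) * g j (entry s j) ≈ g j (entry s j) * f i (entry s i)
      N-commute s adm i∈N j∈N i≢j = commute s adm i≢j (∈-∉⇒≢ i∈N a∉N) (∈-∉⇒≢ j∈N (b∉aN ∘ there))

      expand : ∀ s → Admissible O s →
               word f (M ++ a ∷ N) s * word g (N ++ b ∷ M) s
               ≈ word f M s * (f a (entry s a) * (word fg N s * (g b (entry s b) * word g M s)))
      expand s adm = begin
        word f (M ++ a ∷ N) s * word g (N ++ b ∷ M) s
          ≈⟨ *-cong (∏-++ M (a ∷ N) _) (∏-++ N (b ∷ M) _) ⟩
        (word f M s * (fa * word f N s)) * (word g N s * (gb * word g M s))
          ≈⟨ trans (*-assoc _ _ _) (*-congˡ (trans (*-assoc _ _ _) (*-congˡ (sym (*-assoc _ _ _))))) ⟩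
        word f M s * (fa * ((word f N s * word g N s) * (gb * word g M s)))
          ≈⟨ *-congˡ (*-congˡ (*-congʳ (∏-interleave N _ _
               (Unique⇒AllPairs N-unique (λ i∈N j∈N i≢j → sym (N-commute s adm j∈N i∈N (i≢j ∘ ≡.sym))))))) ⟩
        word f M s * (fa * (word fg N s * (gb * word g M s))) ∎
        where
        fa = f a (entry s a)
        gb = g b (entry s b)

    reduce : ∀ d → degreeSum O d (λ s → word f (M ++ a ∷ N) s * word g (N ++ b ∷ M) s)
                 ≈ degreeSum O d (λ s → (word f M s * (word g N s * word f N s))
                                        * ((vacant (entry s a) * vacant (entry s b)) * word g M s))
    reduce d = begin
      degreeSum O d (λ s → word f (M ++ a ∷ N) s * word g (N ++ b ∷ M) s)
        ≈⟨ degreeSum-cong-admissible O d expand ⟩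
      degreeSum O d (λ s → word f M s * (f a (entry s a) * (word fg N s * (g b (entry s b) * word g M s))))
        ≈⟨ degreeSum-slide O d a (f a) fg gf N aN-unique
             (λ j∈aN → word-ignores f M (λ j∈M → M∌aN j∈M j∈aN))
             (λ j∈aN → *-ignores (letter-ignores (g b) (∈-∉⇒≢ j∈aN b∉aN ∘ ≡.sym))
                                 (word-ignores g M (λ j∈M → M∌aN j∈M j∈aN)))
             (λ j∈N → slide (∈-∉⇒≢ j∈N a∉N) (∈-∉⇒≢ j∈N (b∉aN ∘ there))) ⟩
      degreeSum O d (λ s → word f M s * (word gf N s * (f a (entry s a) * (g b (entry s b) * word g M s))))
        ≈⟨ degreeSum-cong O d (λ s → trans (sym (*-assoc _ _ _)) (*-congˡ (sym (*-assoc _ _ _)))) ⟩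
      degreeSum O d (λ s → (word f M s * word gf N s) * ((f a (entry s a) * g b (entry s b)) * word g M s))
        ≈⟨ degreeSum-exchange O d a≢b
             (*-ignores (word-ignores f M a∉M) (word-ignores gf N a∉N))
             (*-ignores (word-ignores f M b∉M) (word-ignores gf N (b∉aN ∘ there)))
             (word-ignores g M a∉M) (word-ignores g M b∉M) annihilate ⟩
      degreeSum O d (λ s → (word f M s * word gf N s) * ((vacant (entry s a) * vacant (entry s b)) * word g M s))
        ≈⟨ degreeSum-cong-admissible O d (λ s adm → *-congʳ (*-congˡ (sym (∏-interleave N _ _
             (Unique⇒AllPairs N-unique (N-commute s adm)))))) ⟩
      degreeSum O d (λ s → (word f M s * (word g N s * word f N s)) * ((vacant (entry s a) * vacant (entry s b)) * word g M s)) ∎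
      where
      a≢b : a ≢ b
      a≢b a≡b = b∉aN (here (≡.sym a≡b))

  open CyclicSplit (cyclicSplit p≢q) renaming (between to L₁; beyond to L₂)
  open import Data.List.Properties using (filter-none)
  open import Data.Bool using (T)
  open import Data.Nat using (_≡ᵇ_)
  open import Data.Nat.Properties using (≡ᵇ⇒≡; ≡⇒≡ᵇ)
  open import Data.Fin.Subset.Properties using (_∈?_; nonempty?)

  U V : List (Fin n) → State n → Carrier
  U = word û
  V = word v̂

  private
    unique-p : Unique (L₁ ++ q ∷ L₂)
    unique-p = ≡.subst Unique cycOrder-p (cycOrder-unique p)
    unique-q : Unique (L₂ ++ p ∷ L₁)
    unique-q = ≡.subst Unique cycOrder-q (cycOrder-unique q)
    p∉ : p ∉ L₁ ++ q ∷ L₂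
    p∉ = ≡.subst (p ∉_) cycOrder-p (cycOrder-∌ p)
    q∉ : q ∉ L₂ ++ p ∷ L₁
    q∉ = ≡.subst (q ∉_) cycOrder-q (cycOrder-∌ q)
    L₁∌L₂ : ∀ {i} → i ∈ L₁ → i ∉ L₂
    L₁∌L₂ i∈L₁ i∈L₂ = proj₂ (proj₂ (Unique-++⁻ L₁ unique-p)) i∈L₁ (there i∈L₂)
    L₂∌L₁ : ∀ {i} → i ∈ L₂ → i ∉ L₁
    L₂∌L₁ i∈L₂ i∈L₁ = L₁∌L₂ i∈L₁ i∈L₂

  U-V-commute : ∀ s → Admissible O s → ∀ M N → (∀ {i} → i ∈ M → i ∉ N) → q ∉ M → p ∉ N →
                U M s * V N s ≈ V N s * U M s
  U-V-commute s adm M N M∌N q∉M p∉N = ∏-commute N _ (λ j∈N → sym (∏-commute M _ (λ i∈M →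
    sym (letter-commute s adm (∈-∉⇒≢ j∈N (M∌N i∈M) ∘ ≡.sym) (∈-∉⇒≢ i∈M q∉M) (∈-∉⇒≢ j∈N p∉N)))))

  vacant-cases : ∀ x → vacant x ≈ 0# ⊎ vacant x ≈ 1#
  vacant-cases (false , false) = inj₂ refl
  vacant-cases (false , true)  = inj₁ refl
  vacant-cases (true  , _)     = inj₁ refl

  both-vanish : ∀ {e e′ x y x′ y′} → e ≈ 0# → e′ ≈ 0# → x * (e * y) ≈ x′ * (e′ * y′)
  both-vanish e≈0 e′≈0 = trans (trans (*-congˡ (trans (*-congʳ e≈0) (zeroˡ _))) (zeroʳ _))
                               (sym (trans (*-congˡ (trans (*-congʳ e′≈0) (zeroˡ _))) (zeroʳ _)))

  halves-meet : ∀ s → Admissible O s →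
           (U L₁ s * (V L₂ s * U L₂ s)) * ((vacant (entry s q) * vacant (entry s p)) * V L₁ s)
           ≈ (V L₂ s * (U L₁ s * V L₁ s)) * ((vacant (entry s p) * vacant (entry s q)) * U L₂ s)
  halves-meet s adm with vacant-cases (entry s q) | vacant-cases (entry s p)
  ... | inj₁ q≈0 | _         = both-vanish (trans (*-congʳ q≈0) (zeroˡ _)) (trans (*-congˡ q≈0) (zeroʳ _))
  ... | inj₂ _   | inj₁ p≈0  = both-vanish (trans (*-congˡ p≈0) (zeroʳ _)) (trans (*-congʳ p≈0) (zeroˡ _))
  ... | inj₂ q≈1 | inj₂ p≈1  = begin
    (U₁ * (V₂ * U₂)) * ((vacant (entry s q) * vacant (entry s p)) * V₁)
      ≈⟨ *-congˡ (trans (*-congʳ (trans (*-cong q≈1 p≈1) (*-identityˡ 1#))) (*-identityˡ V₁)) ⟩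
    (U₁ * (V₂ * U₂)) * V₁        ≈⟨ trans (*-assoc _ _ _) (*-congˡ (*-assoc _ _ _)) ⟩
    U₁ * (V₂ * (U₂ * V₁))
      ≈⟨ *-congˡ (*-congˡ (U-V-commute s adm L₂ L₁ L₂∌L₁ (q∉ ∘ ∈-++⁺ˡ) (p∉ ∘ ∈-++⁺ˡ))) ⟩
    U₁ * (V₂ * (V₁ * U₂))        ≈⟨ *-assoc _ _ _ ⟨
    (U₁ * V₂) * (V₁ * U₂)
      ≈⟨ *-congʳ (U-V-commute s adm L₁ L₂ L₁∌L₂ (q∉ ∘ ∈-++⁺ʳ L₂ ∘ there) (p∉ ∘ ∈-++⁺ʳ L₁ ∘ there)) ⟩
    (V₂ * U₁) * (V₁ * U₂)        ≈⟨ trans (*-assoc _ _ _) (*-congˡ (sym (*-assoc _ _ _))) ⟩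
    V₂ * ((U₁ * V₁) * U₂)        ≈⟨ *-assoc _ _ _ ⟨
    (V₂ * (U₁ * V₁)) * U₂
      ≈⟨ *-congˡ (trans (*-congʳ (trans (*-cong p≈1 q≈1) (*-identityˡ 1#))) (*-identityˡ U₂)) ⟨
    (V₂ * (U₁ * V₁)) * ((vacant (entry s p) * vacant (entry s q)) * U₂) ∎
    where
    U₁ = U L₁ s
    U₂ = U L₂ s
    V₁ = V L₁ s
    V₂ = V L₂ s

  core : ∀ d → degreeSum O d (λ s → U (L₁ ++ q ∷ L₂) s * V (L₂ ++ p ∷ L₁) s)
               ≈ degreeSum O d (λ s → V (L₂ ++ p ∷ L₁) s * U (L₁ ++ q ∷ L₂) s)
  core d = begin
    degreeSum O d (λ s → U (L₁ ++ q ∷ L₂) s * V (L₂ ++ p ∷ L₁) s)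
      ≈⟨ HalfReduction.reduce û v̂ L₁ L₂ unique-p p∉ letter-commute slide-q annihilate-q d ⟩
    degreeSum O d (λ s → (U L₁ s * (V L₂ s * U L₂ s)) * ((vacant (entry s q) * vacant (entry s p)) * V L₁ s))
      ≈⟨ degreeSum-cong-admissible O d halves-meet ⟩
    degreeSum O d (λ s → (V L₂ s * (U L₁ s * V L₁ s)) * ((vacant (entry s p) * vacant (entry s q)) * U L₂ s))
      ≈⟨ HalfReduction.reduce v̂ û L₂ L₁ unique-q q∉
           (λ s adm i≢j i≢p j≢q → sym (letter-commute s adm (i≢j ∘ ≡.sym) j≢q i≢p)) slide-p annihilate-p d ⟨
    degreeSum O d (λ s → V (L₂ ++ p ∷ L₁) s * U (L₁ ++ q ∷ L₂) s) ∎

  does-∈? : ∀ {m} (A : Subset m) i → does (i ∈? A) ≡ lookup A i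
  does-∈? (true  ∷ A) zero    = ≡.refl
  does-∈? (false ∷ A) zero    = ≡.refl
  does-∈? (_     ∷ A) (suc i) = does-∈? A i

  π-word : ∀ s → πA R unp p (proj₁ s) ≈ U (L₁ ++ q ∷ L₂) s
  π-word (A , B) = begin
    ∏ (filter (_∈? A) (cycOrder p)) unp
      ≈⟨ ∏-filter (_∈? A) (cycOrder p) unp ⟩
    ∏ (cycOrder p) (λ i → if does (i ∈? A) then unp i else 1#)
      ≈⟨ ∏-cong-∈ (cycOrder p) (λ {i} _ → reflexive (≡.cong (if_then unp i else 1#) (does-∈? A i))) ⟩
    U (cycOrder p) (A , B)
      ≡⟨ ≡.cong (λ L → U L (A , B)) cycOrder-p ⟩
    U (L₁ ++ q ∷ L₂) (A , B) ∎

  π′-word : ∀ s → π'B R pr q (proj₂ s) ≈ V (L₂ ++ p ∷ L₁) s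
  π′-word (A , B) = begin
    ∏ (filter (_∈? B) (cycOrder q)) pr
      ≈⟨ ∏-filter (_∈? B) (cycOrder q) pr ⟩
    ∏ (cycOrder q) (λ i → if does (i ∈? B) then pr i else 1#)
      ≈⟨ ∏-cong-∈ (cycOrder q) (λ {i} _ → reflexive (≡.cong (if_then pr i else 1#) (does-∈? B i))) ⟩
    V (cycOrder q) (A , B)
      ≡⟨ ≡.cong (λ L → V L (A , B)) cycOrder-q ⟩
    V (L₂ ++ p ∷ L₁) (A , B) ∎

  π-empty : ∀ {A} → ¬ Nonempty A → πA R unp p A ≡ 1#
  π-empty {A} A-empty = ≡.cong (λ L → prodR R (map unp L))
    (filter-none (_∈? A) {xs = cycOrder p} (All.tabulate (λ {i} _ i∈A → A-empty (i , i∈A))))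

  π′-empty : ∀ {B} → ¬ Nonempty B → π'B R pr q B ≡ 1#
  π′-empty {B} B-empty = ≡.cong (λ L → prodR R (map pr L))
    (filter-none (_∈? B) {xs = cycOrder q} (All.tabulate (λ {i} _ i∈B → B-empty (i , i∈B))))

  commutator : State n → Carrier
  commutator (A , B) = πA R unp p A * π'B R pr q B - π'B R pr q B * πA R unp p A

  commutator-vanishes : ∀ s → ¬ Nonempty (proj₁ s) ⊎ ¬ Nonempty (proj₂ s) → commutator s ≈ 0#
  commutator-vanishes (A , B) (inj₁ A-empty) rewrite π-empty A-empty =
    x≈y⇒x∙y⁻¹≈ε (trans (*-identityˡ _) (sym (*-identityʳ _)))
  commutator-vanishes (A , B) (inj₂ B-empty) rewrite π′-empty B-empty =
    x≈y⇒x∙y⁻¹≈ε (trans (*-identityʳ _) (sym (*-identityˡ _)))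

  module _ (d : ℕ) where

    ππ′ π′π : State n → Carrier
    ππ′ (A , B) = πA R unp p A * π'B R pr q B
    π′π (A , B) = π'B R pr q B * πA R unp p A

    summand : State n → Carrier
    summand s = if does (cond? X p q d s) then commutator s else 0#

    cond⇒supported : ∀ {s} → Cond X p q d s → Supported s
    cond⇒supported (X⊆ , ⊆X , _ , _ , _ , p∉A , q∉B) = X⊆ , ⊆X , p∉A , q∉B

    summand-inadmissible : ∀ s → ¬ Admissible O s → summand s ≈ 0#
    summand-inadmissible s ¬adm = by-cond (cond? X p q d s)
      where
      by-cond : (D : Dec (Cond X p q d s)) → (if does D then commutator s else 0#) ≈ 0#
      by-cond (yes cond) = ⊥-elim (¬adm (supported⇒admissible s (cond⇒supported cond)))
      by-cond (no _)     = refl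

    summand-admissible : ∀ s → Admissible O s →
      summand s ≈ (if degree s ≡ᵇ d then ππ′ s else 0#) - (if degree s ≡ᵇ d then π′π s else 0#)
    summand-admissible s adm = by-cond (degree s ≡ᵇ d) ≡.refl (cond? X p q d s)
      where
      by-cond : ∀ b → (degree s ≡ᵇ d) ≡ b → (D : Dec (Cond X p q d s)) →
                (if does D then commutator s else 0#) ≈ (if b then ππ′ s else 0#) - (if b then π′π s else 0#)
      by-cond true  _      (yes _)    = refl
      by-cond false deg≢d  (yes cond) = case ≡.subst T deg≢d (≡⇒≡ᵇ _ _ (proj₁ (proj₂ (proj₂ cond)))) of λ ()
      by-cond false _      (no _)     = sym (-‿inverseʳ 0#)
      by-cond true  deg≡d  (no ¬cond) with nonempty? (proj₁ s) | nonempty? (proj₂ s)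
      ... | no A-empty | _          = sym (commutator-vanishes s (inj₁ A-empty))
      ... | yes _      | no B-empty = sym (commutator-vanishes s (inj₂ B-empty))
      ... | yes A-ne   | yes B-ne   with X⊆ , ⊆X , p∉A , q∉B ← admissible⇒supported s adm =
        ⊥-elim (¬cond (X⊆ , ⊆X , ≡ᵇ⇒≡ _ _ (≡.subst T (≡.sym deg≡d) _) , A-ne , B-ne , p∉A , q∉B))

    commSum≈0 : commSum R X p q d unp pr ≈ 0#
    commSum≈0 = begin
      commSum R X p q d unp pr
        ≈⟨ ∑-filter (cond? X p q d) (cartesianProduct S S) commutator ⟩
      ∑ (cartesianProduct S S) summand
        ≈⟨ ∑-cartesianProduct S S summand ⟩
      ∑ S (λ A → ∑ S (λ B → summand (A , B)))
        ≈⟨ ∑-allSubsets² n summand ⟩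
      sumStates (λ _ → allEntries) summand
        ≈⟨ sumStates-restrict O (λ _ → allEntries) (λ j → ∑-filter-supported (allowed? (kind j)) allEntries)
                              summand summand-inadmissible ⟩
      sumStates O summand
        ≈⟨ sumStates-cong-admissible O summand-admissible ⟩
      sumStates O (λ s → (if degree s ≡ᵇ d then ππ′ s else 0#) - (if degree s ≡ᵇ d then π′π s else 0#))
        ≈⟨ sumStates-− O _ _ ⟩
      degreeSum O d ππ′ - degreeSum O d π′π
        ≈⟨ +-congʳ (trans (degreeSum-cong O d (λ s → *-cong (π-word s) (π′-word s)))
                   (trans (core d) (degreeSum-cong O d (λ s → sym (*-cong (π′-word s) (π-word s)))))) ⟩
      degreeSum O d π′π - degreeSum O d π′π
        ≈⟨ -‿inverseʳ _ ⟩
      0# ∎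
      where S = allSubsets n


open import Data.Nat using (ℕ; _≤_; _+_; _*_)
open import Data.Fin.Subset using (Subset; _∉_; Nonempty; ∣_∣)
open import Relation.Binary.PropositionalEquality using (_≡_)

lemma2p3 : ∀ {c ℓ : Level} (R : Ring c ℓ) (n : ℕ) → 3 ≤ n →
    (p q : Fin n) → ¬ (p ≡ q) →
    (X : Subset n) → Nonempty X → p ∉ X → q ∉ X →
    (unp pr : Fin n → Ring.Carrier R) (star : Ring.Carrier R) →
    Relations R X p q unp pr star →
    (d : ℕ) → ∣ X ∣ ≤ d → d ≤ 2 * ∣ X ∣ + 2 →
    Ring._≈_ R (commSum R X p q d unp pr) (Ring.0# R)
lemma2p3 R n _ p q p≢q X _ p∉X q∉X unp pr star rels d _ _ =
  CommutatorSum.commSum≈0 R X p≢q p∉X q∉X unp pr star rels d
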